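{- Let $\alpha,\beta$ be complex numbers with $\alpha+\beta=-1$, let $u_1,\dots,u_4$ be complex numbers, and set $\Delta=(u_3+u_4)^2-4u_1u_2$. For $n\ge1$, $$2^nP_n(u_1,u_2,u_3,u_4\mid\alpha,\beta)=\sum_{k=0}^{\lfloor n/2\rfloor}\binom n{2k}\Delta^k(\beta-\alpha)^{n-2k}(u_3-u_4)^{n-2k}-(u_3+u_4)\sum_{k=0}^{\lfloor n/2\rfloor}\binom n{2k+1}\Delta^k(\beta-\alpha)^{n-2k-1}(u_3-u_4)^{n-2k-1}.$$
   Context: $\mathfrak S_m$ is the set of permutations $\sigma=\sigma_1\cdots\sigma_m$ of $[m]$. ${\rm V}(\sigma)$ = number of $1<i<m$ with $\sigma_{i-1}>\sigma_i<\sigma_{i+1}$; ${\rm W}(\sigma)$ = number of $1\le i\le m$ with $\sigma_{i-1}<\sigma_i>\sigma_{i+1}$ where $\sigma_0=\sigma_{m+1}=0$; ${\rm rdd}(\sigma)$ = number of $1<i\le m$ with $\sigma_{i-1}>\sigma_i>\sigma_{i+1}$ where $\sigma_{m+1}=0$; ${\rm lda}(\sigma)$ = number of $1\le i<m$ with $\sigma_{i-1}<\sigma_i<\sigma_{i+1}$ where $\sigma_0=0$; ${\rm LRmax}(\sigma)$, ${\rm RLmax}(\sigma)$ = numbers of left-to-right and right-to-left maxima. $P_n(u_1,u_2,u_3,u_4\mid\alpha,\beta)=\sum_{\sigma\in\mathfrak S_{n+1}}u_1^{{\rm V}(\sigma)}u_2^{{\rm W}(\sigma)-1}u_3^{{\rm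 rdd}(\sigma)}u_4^{{\rm lda}(\sigma)}\alpha^{{\rm LRmax}(\sigma)-1}\beta^{{\rm RLmax}(\sigma)-1}$. Conventions: $0^0=1$ and $\binom{n}{j}=0$ for $j>n$. -}

module Defs where

open import Data.Nat using (ℕ; zero; suc; _∸_; _<ᵇ_; ⌊_/2⌋) renaming (_*_ to _*ℕ_)
open import Data.Nat.Combinatorics using (_C_)
open import Data.Bool using (Bool; true; false; if_then_else_; _∧_)
open import Data.List using (List; []; _∷_; map; concatMap; reverse; foldr; length)
open import Algebra.Bundles using (CommutativeRing)

-- Permutations of [m] = {1,…,m}, represented as lists σ₁ ⋯ σₘ.
-- S m enumerates 𝔖_m (each permutation exactly once), built by inserting
-- m into every position of every permutation of [m-1].

insertAll : ℕ → List ℕ → List (List ℕ)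
insertAll x []       = (x ∷ []) ∷ []
insertAll x (y ∷ ys) = (x ∷ y ∷ ys) ∷ map (y ∷_) (insertAll x ys)

S : ℕ → List (List ℕ)
S zero    = [] ∷ []
S (suc m) = concatMap (insertAll (suc m)) (S m)

-- σ_i (1-indexed), with the convention σ_0 = σ_{m+1} = 0.

at : List ℕ → ℕ → ℕ
at σ zero = 0
at [] (suc i) = 0
at (x ∷ xs) (suc zero) = x
at (x ∷ xs) (suc (suc i)) = at xs (suc i)

countRange : (ℕ → Bool) → ℕ → ℕ → ℕ
countRange p a b = go (suc b ∸ a) a
  where
  go : ℕ → ℕ → ℕ
  go zero    i = 0
  go (suc k) i = if p i then suc (go k (suc i)) else go k (suc i)

V : List ℕ → ℕ
V σ = countRange (λ i → (at σ i <ᵇ at σ (i ∸ 1)) ∧ (at σ i <ᵇ at σ (suc i)))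
                 2 (length σ ∸ 1)

W : List ℕ → ℕ
W σ = countRange (λ i → (at σ (i ∸ 1) <ᵇ at σ i) ∧ (at σ (suc i) <ᵇ at σ i))
                 1 (length σ)

rdd : List ℕ → ℕ
rdd σ = countRange (λ i → (at σ i <ᵇ at σ (i ∸ 1)) ∧ (at σ (suc i) <ᵇ at σ i))
                   2 (length σ)

lda : List ℕ → ℕ
lda σ = countRange (λ i → (at σ (i ∸ 1) <ᵇ at σ i) ∧ (at σ i <ᵇ at σ (suc i)))
                   1 (length σ ∸ 1)

lrmaxFrom : ℕ → List ℕ → ℕ
lrmaxFrom cur []       = 0
lrmaxFrom cur (x ∷ xs) = if cur <ᵇ x then suc (lrmaxFrom x xs) else lrmaxFrom cur xs

LRmax : List ℕ → ℕ
LRmax σ = lrmaxFrom 0 σ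

RLmax : List ℕ → ℕ
RLmax σ = LRmax (reverse σ)

module _ {c ℓ} (R : CommutativeRing c ℓ) where
  open CommutativeRing R

  pow : Carrier → ℕ → Carrier     -- x ^ 0 = 1 (so 0^0 = 1)
  pow x zero    = 1#
  pow x (suc n) = x * pow x n

  natR : ℕ → Carrier
  natR zero    = 0#
  natR (suc n) = 1# + natR n

  sumTo : ℕ → (ℕ → Carrier) → Carrier
  sumTo zero    f = f 0
  sumTo (suc N) f = sumTo N f + f (suc N)

  sumList : List Carrier → Carrier
  sumList = foldr _+_ 0#

  P : ℕ → Carrier → Carrier → Carrier → Carrier → Carrier → Carrier → Carrier
  P n u₁ u₂ u₃ u₄ α β = sumList (map term (S (suc n)))
    where
    term : List ℕ → Carrier
    term σ = pow u₁ (V σ) * pow u₂ (W σ ∸ 1) * pow u₃ (rdd σ) * pow u₄ (lda σ)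
             * pow α (LRmax σ ∸ 1) * pow β (RLmax σ ∸ 1)

  RHS : ℕ → Carrier → Carrier → Carrier → Carrier → Carrier → Carrier → Carrier
  RHS n u₁ u₂ u₃ u₄ α β =
    sumTo ⌊ n /2⌋ (λ k → natR (n C (2 *ℕ k)) * pow Δ k
                         * pow (β - α) (n ∸ 2 *ℕ k) * pow (u₃ - u₄) (n ∸ 2 *ℕ k))
    - (u₃ + u₄) * sumTo ⌊ n /2⌋ (λ k → natR (n C suc (2 *ℕ k)) * pow Δ k
                         * pow (β - α) (n ∸ suc (2 *ℕ k)) * pow (u₃ - u₄) (n ∸ suc (2 *ℕ k)))
    where
    Δ : Carrier
    Δ = pow (u₃ + u₄) 2 - (natR 4 * u₁ * u₂)

{-# OPTIONS --safe #-}
module Submission where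

-- Write Pₙ as a weighted sum over permutations built by repeatedly inserting a new minimum 1
-- into shifted permutations.  The weight of a permutation is a product of letter weights
-- (peak 1, valley u₁u₂, double descent u₃, double ascent u₄) times α^(LRmax-1) β^(RLmax-1).
-- Inserting 1 in front multiplies the weight by α u₄, inserting it at the end by β u₃, and the
-- interior insertions add up to the derivative of the weight along the derivation D with
-- D u₁ = (u₃ + u₄) u₁ and D u₃ = D u₄ = u₁u₂.  Hence Qₘ₊₁ = y Qₘ + D Qₘ with y = α u₄ + β u₃.
-- When α + β = -1 we get D y = -u₁u₂, and c₁ = 2y + u₃ + u₄, c₂ = y² + y (u₃ + u₄) + u₁u₂ are
-- D-constants; computing D with dual numbers turns this into Qₘ₊₃ = c₁ Qₘ₊₂ - c₂ Qₘ₊₁.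
-- Scaled by 2ⁿ this is the recurrence with characteristic roots ξ ± √Δ, ξ = (β - α)(u₃ - u₄),
-- which the binomial sums of the right-hand side satisfy too; both sides agree for n = 0, 1.

open import Data.Nat as ℕ using (ℕ; zero; suc; _≤_; _<_; _<ᵇ_; _∸_; _≥_; z≤n; s≤s; ⌊_/2⌋)
import Data.Nat.Properties as ℕ
open import Data.Nat.Combinatorics using (_C_; nCk+nC[k+1]≡[n+1]C[k+1]; k>n⇒nCk≡0)
open import Data.Bool using (Bool; true; false; if_then_else_; _∧_; not)
open import Data.Empty using (⊥-elim)
open import Data.Integer as ℤ using (ℤ; -[1+_]; _⊖_)
import Data.Integer.Properties as ℤ
open import Data.Sign as Sign using (Sign)
open import Data.Maybe using (Maybe; just; nothing)
open import Data.Product using (_×_; _,_; proj₁; proj₂)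
open import Data.List using (List; []; _∷_; map; concatMap; _++_; _∷ʳ_; foldr; reverse; length)
import Data.List.Properties as List
open import Data.List.Relation.Unary.All as All using (All; []; _∷_)
import Data.List.Relation.Unary.All.Properties as All
open import Relation.Nullary using (yes; no)
open import Relation.Binary.PropositionalEquality as ≡ using (_≡_; _≢_)
open import Algebra.Bundles using (CommutativeRing)
open import Algebra.Structures using (IsCommutativeRing)
import Algebra.Solver.Ring.AlmostCommutativeRing as ACR
open import Defs

module IntegerCoefficients {c ℓ} (R : CommutativeRing c ℓ) where
  open import Data.Integer using (+_)
  open CommutativeRing R
  open import Algebra.Properties.Ring ring using (-‿involutive; -0#≈0#; -‿distribˡ-*; -‿distribʳ-*; -‿+-comm)
  open import Algebra.Properties.Semiring.Mult.TCOptimised semiring using (1+×; ×-homo-+; ×1-homo-*) renaming (_×_ to _·_)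
  open import Relation.Binary.Reasoning.Setoid setoid

  ⟦_⟧ : ℤ → Carrier
  ⟦ + n ⟧    = n · 1#
  ⟦ -[1+ n ] ⟧ = - (suc n · 1#)

  ⊖-homo : ∀ m n → ⟦ m ⊖ n ⟧ ≈ m · 1# - n · 1#
  ⊖-homo zero    zero    = sym (-‿inverseʳ 0#)
  ⊖-homo zero    (suc n) = sym (+-identityˡ _)
  ⊖-homo (suc m) zero    = sym (trans (+-congˡ -0#≈0#) (+-identityʳ _))
  ⊖-homo (suc m) (suc n) = begin
    ⟦ suc m ⊖ suc n ⟧                ≡⟨ ≡.cong ⟦_⟧ (ℤ.[1+m]⊖[1+n]≡m⊖n m n) ⟩
    ⟦ m ⊖ n ⟧                        ≈⟨ ⊖-homo m n ⟩
    m · 1# - n · 1#                  ≈⟨ +-congʳ (trans (+-congʳ (-‿inverseʳ 1#)) (+-identityˡ _)) ⟨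
    (1# - 1#) + m · 1# - n · 1#      ≈⟨ +-congʳ (+-assoc 1# (- 1#) (m · 1#)) ⟩
    1# + (- 1# + m · 1#) - n · 1#    ≈⟨ +-congʳ (+-congˡ (+-comm (- 1#) (m · 1#))) ⟩
    1# + (m · 1# - 1#) - n · 1#      ≈⟨ +-congʳ (+-assoc 1# (m · 1#) (- 1#)) ⟨
    1# + m · 1# - 1# - n · 1#        ≈⟨ +-assoc (1# + m · 1#) (- 1#) (- (n · 1#)) ⟩
    1# + m · 1# + (- 1# - n · 1#)    ≈⟨ +-cong (1+× m 1#) (trans (-‿cong (1+× n 1#)) (sym (-‿+-comm 1# (n · 1#)))) ⟨
    suc m · 1# - suc n · 1#          ∎

  +-homo : ∀ i j → ⟦ i ℤ.+ j ⟧ ≈ ⟦ i ⟧ + ⟦ j ⟧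
  +-homo -[1+ m ] -[1+ n ] = begin
    - (suc (suc (m ℕ.+ n)) · 1#)     ≡⟨ ≡.cong (λ k → - (suc k · 1#)) (ℕ.+-suc m n) ⟨
    - ((suc m ℕ.+ suc n) · 1#)       ≈⟨ -‿cong (×-homo-+ 1# (suc m) (suc n)) ⟩
    - (suc m · 1# + suc n · 1#)      ≈⟨ -‿+-comm _ _ ⟨
    - (suc m · 1#) - suc n · 1#      ∎
  +-homo -[1+ m ] (+ n)    = trans (⊖-homo n (suc m)) (+-comm _ _)
  +-homo (+ m)    -[1+ n ] = ⊖-homo m (suc n)
  +-homo (+ m)    (+ n)    = ×-homo-+ 1# m n

  sign : Sign → Carrier
  sign Sign.+ = 1#
  sign Sign.- = - 1#

  sign-homo : ∀ s t → sign (s Sign.* t) ≈ sign s * sign t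
  sign-homo Sign.+ t      = sym (*-identityˡ _)
  sign-homo Sign.- Sign.+ = sym (*-identityʳ _)
  sign-homo Sign.- Sign.- = begin
    1#                ≈⟨ -‿involutive 1# ⟨
    - - 1#            ≈⟨ -‿cong (-‿cong (*-identityʳ 1#)) ⟨
    - - (1# * 1#)     ≈⟨ -‿cong (-‿distribˡ-* 1# 1#) ⟩
    - (- 1# * 1#)     ≈⟨ -‿distribʳ-* (- 1#) 1# ⟩
    - 1# * - 1#       ∎

  ◃-homo : ∀ s n → ⟦ s ℤ.◃ n ⟧ ≈ sign s * n · 1#
  ◃-homo s      zero    = sym (zeroʳ _)
  ◃-homo Sign.+ (suc n) = sym (*-identityˡ _)
  ◃-homo Sign.- (suc n) = trans (-‿cong (sym (*-identityˡ _))) (-‿distribˡ-* 1# _)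

  sign-abs : ∀ i → ⟦ i ⟧ ≈ sign (ℤ.sign i) * ℤ.∣ i ∣ · 1#
  sign-abs i = trans (reflexive (≡.cong ⟦_⟧ (≡.sym (ℤ.◃-inverse i)))) (◃-homo (ℤ.sign i) ℤ.∣ i ∣)

  *-homo : ∀ i j → ⟦ i ℤ.* j ⟧ ≈ ⟦ i ⟧ * ⟦ j ⟧
  *-homo i j = begin
    ⟦ (s Sign.* t) ℤ.◃ (m ℕ.* n) ⟧          ≈⟨ ◃-homo (s Sign.* t) (m ℕ.* n) ⟩
    sign (s Sign.* t) * (m ℕ.* n) · 1#      ≈⟨ *-cong (sign-homo s t) (×1-homo-* m n) ⟩
    (sign s * sign t) * (m · 1# * n · 1#)   ≈⟨ interchange _ _ _ _ ⟩
    (sign s * m · 1#) * (sign t * n · 1#)   ≈⟨ *-cong (sign-abs i) (sign-abs j) ⟨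
    ⟦ i ⟧ * ⟦ j ⟧                           ∎
    where
    open import Algebra.Properties.CommutativeSemigroup *-commutativeSemigroup using (interchange)
    s t : Sign
    s = ℤ.sign i
    t = ℤ.sign j
    m n : ℕ
    m = ℤ.∣ i ∣
    n = ℤ.∣ j ∣

  neg-homo : ∀ i → ⟦ ℤ.- i ⟧ ≈ - ⟦ i ⟧
  neg-homo -[1+ n ]    = sym (-‿involutive _)
  neg-homo (+ zero)    = sym -0#≈0#
  neg-homo (+ suc n)   = refl

  almostCommutativeRing : ACR.AlmostCommutativeRing c ℓ
  almostCommutativeRing = ACR.fromCommutativeRing R

  homomorphism : ℤ.+-*-rawRing ACR.-Raw-AlmostCommutative⟶ almostCommutativeRing
  homomorphism = record
    { ⟦_⟧ = ⟦_⟧ ; +-homo = +-homo ; *-homo = *-homo ; -‿homo = neg-homo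
    ; 0-homo = refl ; 1-homo = refl }

  ⟦⟧-≟ : ∀ i j → Maybe (⟦ i ⟧ ≈ ⟦ j ⟧)
  ⟦⟧-≟ i j with i ℤ.≟ j
  ... | yes ≡.refl = just refl
  ... | no _       = nothing

  open import Algebra.Solver.Ring ℤ.+-*-rawRing almostCommutativeRing homomorphism ⟦⟧-≟ public
    using (solve; _:=_; _:+_; _:*_; _:-_; :-_; Polynomial; con)

  :0 :1 : ∀ {n} → Polynomial n
  :0 = con (+ 0)
  :1 = con (+ 1)

module DualNumbers {c ℓ} (R : CommutativeRing c ℓ) where
  open CommutativeRing R
  open IntegerCoefficients R

  infix  4 _≈ε_
  infixl 6 _+ε_
  infixl 7 _*ε_

  -- a pair (a , a') stands for a + a' ε, where ε² = 0
  Dual : Set c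
  Dual = Carrier × Carrier

  _≈ε_ : Dual → Dual → Set ℓ
  (a , a') ≈ε (b , b') = (a ≈ b) × (a' ≈ b')

  _+ε_ _*ε_ : Dual → Dual → Dual
  (a , a') +ε (b , b') = (a + b , a' + b')
  (a , a') *ε (b , b') = (a * b , a * b' + a' * b)

  -ε_ : Dual → Dual
  -ε (a , a') = (- a , - a')

  dual-isCommutativeRing : IsCommutativeRing _≈ε_ _+ε_ _*ε_ -ε_ (0# , 0#) (1# , 0#)
  dual-isCommutativeRing = record
    { isRing = record
      { +-isAbelianGroup = record
        { isGroup = record
          { isMonoid = record
            { isSemigroup = record
              { isMagma = record
                { isEquivalence = record
                  { refl  = refl , refl
                  ; sym   = λ (p , q) → sym p , sym q
                  ; trans = λ (p , q) (p' , q') → trans p p' , trans q q' }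
                ; ∙-cong = λ (p , q) (p' , q') → +-cong p p' , +-cong q q' }
              ; assoc = λ _ _ _ → +-assoc _ _ _ , +-assoc _ _ _ }
            ; identity = (λ _ → +-identityˡ _ , +-identityˡ _) , (λ _ → +-identityʳ _ , +-identityʳ _) }
          ; inverse = (λ _ → -‿inverseˡ _ , -‿inverseˡ _) , (λ _ → -‿inverseʳ _ , -‿inverseʳ _)
          ; ⁻¹-cong = λ (p , q) → -‿cong p , -‿cong q }
        ; comm = λ _ _ → +-comm _ _ , +-comm _ _ }
      ; *-cong = λ (p , q) (p' , q') → *-cong p p' , +-cong (*-cong p q') (*-cong q p')
      ; *-assoc = λ (a , a') (b , b') (d , d') → *-assoc a b d ,
          solve 6 (λ a a' b b' d d' → (a :* b) :* d' :+ (a :* b' :+ a' :* b) :* d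
                                     := a :* (b :* d' :+ b' :* d) :+ a' :* (b :* d)) refl a a' b b' d d'
      ; *-identity =
          (λ (a , a') → *-identityˡ a ,
             solve 2 (λ a a' → :1 :* a' :+ :0 :* a := a') refl a a') ,
          (λ (a , a') → *-identityʳ a ,
             solve 2 (λ a a' → a :* :0 :+ a' :* :1 := a') refl a a')
      ; distrib =
          (λ (a , a') (b , b') (d , d') → distribˡ a b d ,
             solve 6 (λ a a' b b' d d' → a :* (b' :+ d') :+ a' :* (b :+ d)
                                        := (a :* b' :+ a' :* b) :+ (a :* d' :+ a' :* d)) refl a a' b b' d d') ,
          (λ (a , a') (b , b') (d , d') → distribʳ a b d ,
             solve 6 (λ a a' b b' d d' → (b :+ d) :* a' :+ (b' :+ d') :* a
                                        := (b :* a' :+ b' :* a) :+ (d :* a' :+ d' :* a)) refl a a' b b' d d') }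
    ; *-comm = λ (a , a') (b , b') → *-comm a b ,
        solve 4 (λ a a' b b' → a :* b' :+ a' :* b := b :* a' :+ b' :* a) refl a a' b b' }

  commutativeRing : CommutativeRing c ℓ
  commutativeRing = record { isCommutativeRing = dual-isCommutativeRing }

_[ε] : ∀ {c ℓ} → CommutativeRing c ℓ → CommutativeRing c ℓ
R [ε] = DualNumbers.commutativeRing R

module Permutations where

  open import Data.Nat using (_⊔_; _+_)
  open import Data.Nat.Properties
  open import Data.Bool using (T)
  open import Data.Unit using (⊤; tt)
  open import Relation.Binary.PropositionalEquality

  -- 𝔖_m again, now built by inserting the minimum 1 into every position of every
  -- shifted permutation of [m-1].
  S′ : ℕ → List (List ℕ)
  S′ zero    = [] ∷ []
  S′ (suc m) = concatMap (λ τ → insertAll 1 (map suc τ)) (S′ m)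

  map-suc-insertAll : ∀ m τ → map (map suc) (insertAll m τ) ≡ insertAll (suc m) (map suc τ)
  map-suc-insertAll m []       = refl
  map-suc-insertAll m (t ∷ ts) = cong ((suc m ∷ suc t ∷ map suc ts) ∷_) (begin
    map (map suc) (map (t ∷_) (insertAll m ts))   ≡⟨ List.map-∘ (insertAll m ts) ⟨
    map (λ σ → suc t ∷ map suc σ) (insertAll m ts) ≡⟨ List.map-∘ (insertAll m ts) ⟩
    map (suc t ∷_) (map (map suc) (insertAll m ts)) ≡⟨ cong (map (suc t ∷_)) (map-suc-insertAll m ts) ⟩
    map (suc t ∷_) (insertAll (suc m) (map suc ts)) ∎)
    where open ≡-Reasoning

  insertAllButLast : ℕ → List ℕ → List (List ℕ)
  insertAllButLast x []       = []
  insertAllButLast x (y ∷ ys) = (x ∷ y ∷ ys) ∷ map (y ∷_) (insertAllButLast x ys)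

  insertAll≡insertAllButLast++∷ʳ : ∀ x ys → insertAll x ys ≡ insertAllButLast x ys ∷ʳ (ys ∷ʳ x)
  insertAll≡insertAllButLast++∷ʳ x []       = refl
  insertAll≡insertAllButLast++∷ʳ x (y ∷ ys) = cong ((x ∷ y ∷ ys) ∷_)
    (trans (cong (map (y ∷_)) (insertAll≡insertAllButLast++∷ʳ x ys)) (List.map-++ (y ∷_) (insertAllButLast x ys) _))

  𝟙 : Bool → ℕ
  𝟙 true  = 1
  𝟙 false = 0

  <ᵇ≡true⇒< : ∀ {m n} → (m <ᵇ n) ≡ true → m < n
  <ᵇ≡true⇒< {m} {n} eq = <ᵇ⇒< m n (subst T (sym eq) tt)

  <ᵇ≡false⇒≥ : ∀ {m n} → (m <ᵇ n) ≡ false → n ≤ m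
  <ᵇ≡false⇒≥ eq = ≮⇒≥ (λ m<n → subst T eq (<⇒<ᵇ m<n))

  ≥⇒<ᵇ≡false : ∀ {m n} → n ≤ m → (m <ᵇ n) ≡ false
  ≥⇒<ᵇ≡false {m}     {zero}  _         = refl
  ≥⇒<ᵇ≡false {suc m} {suc n} (s≤s n≤m) = ≥⇒<ᵇ≡false n≤m

  maximum : List ℕ → ℕ
  maximum = foldr _⊔_ 0

  rlmax : List ℕ → ℕ
  rlmax []       = 0
  rlmax (x ∷ xs) = if maximum xs <ᵇ x then suc (rlmax xs) else rlmax xs

  maximum-++ : ∀ zs ws → maximum (zs ++ ws) ≡ maximum zs ⊔ maximum ws
  maximum-++ []       ws = refl
  maximum-++ (z ∷ zs) ws = trans (cong (z ⊔_) (maximum-++ zs ws)) (sym (⊔-assoc z (maximum zs) (maximum ws)))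

  maximum-reverse : ∀ xs → maximum (reverse xs) ≡ maximum xs
  maximum-reverse []       = refl
  maximum-reverse (x ∷ xs) = begin
    maximum (reverse (x ∷ xs))         ≡⟨ cong maximum (List.unfold-reverse x xs) ⟩
    maximum (reverse xs ∷ʳ x)          ≡⟨ maximum-++ (reverse xs) (x ∷ []) ⟩
    maximum (reverse xs) ⊔ (x ⊔ 0)     ≡⟨ cong₂ _⊔_ (maximum-reverse xs) (⊔-identityʳ x) ⟩
    maximum xs ⊔ x                     ≡⟨ ⊔-comm (maximum xs) x ⟩
    x ⊔ maximum xs                     ∎
    where open ≡-Reasoning

  lrmaxFrom-∷ʳ : ∀ c zs x → lrmaxFrom c (zs ∷ʳ x) ≡ lrmaxFrom c zs + 𝟙 ((c ⊔ maximum zs) <ᵇ x)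
  lrmaxFrom-∷ʳ c [] x rewrite ⊔-identityʳ c with c <ᵇ x
  ... | true  = refl
  ... | false = refl
  lrmaxFrom-∷ʳ c (z ∷ zs) x with c <ᵇ z in eq
  ... | true  = cong suc (trans (lrmaxFrom-∷ʳ z zs x) (cong (λ w → lrmaxFrom z zs + 𝟙 (w <ᵇ x)) (sym absorbed)))
    where
    absorbed : c ⊔ (z ⊔ maximum zs) ≡ z ⊔ maximum zs
    absorbed = m≤n⇒m⊔n≡n (≤-trans (<⇒≤ (<ᵇ≡true⇒< eq)) (m≤m⊔n z (maximum zs)))
  ... | false = trans (lrmaxFrom-∷ʳ c zs x) (cong (λ w → lrmaxFrom c zs + 𝟙 (w <ᵇ x)) absorbed)
    where
    absorbed : c ⊔ maximum zs ≡ c ⊔ (z ⊔ maximum zs)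
    absorbed = trans (cong (_⊔ maximum zs) (sym (m≥n⇒m⊔n≡m (<ᵇ≡false⇒≥ eq)))) (⊔-assoc c z (maximum zs))

  RLmax≡rlmax : ∀ σ → RLmax σ ≡ rlmax σ
  RLmax≡rlmax []       = refl
  RLmax≡rlmax (x ∷ xs) = begin
    lrmaxFrom 0 (reverse (x ∷ xs))                          ≡⟨ cong (lrmaxFrom 0) (List.unfold-reverse x xs) ⟩
    lrmaxFrom 0 (reverse xs ∷ʳ x)                           ≡⟨ lrmaxFrom-∷ʳ 0 (reverse xs) x ⟩
    lrmaxFrom 0 (reverse xs) + 𝟙 (maximum (reverse xs) <ᵇ x)
      ≡⟨ cong₂ (λ a b → a + 𝟙 (b <ᵇ x)) (RLmax≡rlmax xs) (maximum-reverse xs) ⟩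
    rlmax xs + 𝟙 (maximum xs <ᵇ x)                          ≡⟨ +-𝟙 (maximum xs <ᵇ x) ⟩
    rlmax (x ∷ xs)                                           ∎
    where
    open ≡-Reasoning
    +-𝟙 : ∀ b → rlmax xs + 𝟙 b ≡ (if b then suc (rlmax xs) else rlmax xs)
    +-𝟙 true  = +-comm (rlmax xs) 1
    +-𝟙 false = +-identityʳ (rlmax xs)

  lrmaxFrom-map-suc : ∀ c zs → lrmaxFrom (suc c) (map suc zs) ≡ lrmaxFrom c zs
  lrmaxFrom-map-suc c []       = refl
  lrmaxFrom-map-suc c (z ∷ zs) with c <ᵇ z
  ... | true  = cong suc (lrmaxFrom-map-suc z zs)
  ... | false = lrmaxFrom-map-suc c zs

  maximum-map-suc : ∀ z zs → maximum (map suc (z ∷ zs)) ≡ suc (maximum (z ∷ zs))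
  maximum-map-suc z []       = cong suc (sym (⊔-identityʳ z))
  maximum-map-suc z (w ∷ ws) = cong (suc z ⊔_) (maximum-map-suc w ws)

  rlmax-map-suc : ∀ ρ → All (1 ≤_) ρ → rlmax (map suc ρ) ≡ rlmax ρ
  rlmax-map-suc []            _        = refl
  rlmax-map-suc (suc k ∷ [])  _        = refl
  rlmax-map-suc (k ∷ w ∷ ws)  (_ ∷ ps) rewrite maximum-map-suc w ws with maximum (w ∷ ws) <ᵇ k
  ... | true  = cong suc (rlmax-map-suc (w ∷ ws) ps)
  ... | false = rlmax-map-suc (w ∷ ws) ps

  rlmax-positive : ∀ x xs → All (1 ≤_) (x ∷ xs) → 1 ≤ rlmax (x ∷ xs)
  rlmax-positive x []       (s≤s z≤n ∷ _) = s≤s z≤n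
  rlmax-positive x (y ∷ ys) (_ ∷ ps) with maximum (y ∷ ys) <ᵇ x
  ... | true  = s≤s z≤n
  ... | false = rlmax-positive y ys ps

  1≤maximum : ∀ z zs → 2 ≤ z → 1 ≤ maximum (z ∷ zs)
  1≤maximum z zs 2≤z = ≤-trans (s≤s z≤n) (≤-trans 2≤z (m≤m⊔n z (maximum zs)))

  rlmax-1∷ : ∀ z zs → 2 ≤ z → rlmax (1 ∷ z ∷ zs) ≡ rlmax (z ∷ zs)
  rlmax-1∷ z zs 2≤z rewrite ≥⇒<ᵇ≡false {maximum (z ∷ zs)} {1} (1≤maximum z zs 2≤z) = refl

  lrmaxFrom-insertAllButLast : ∀ c zs → 1 ≤ c → All (1 ≤_) zs →
    All (λ ys → lrmaxFrom c ys ≡ lrmaxFrom c zs) (insertAllButLast 1 zs)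
  lrmaxFrom-insertAllButLast c       []       _         _        = []
  lrmaxFrom-insertAllButLast (suc c) (z ∷ zs) (s≤s z≤n) (pz ∷ ps) = refl ∷ All.map⁺ (after-z (suc c <ᵇ z) refl)
    where
    after-z : ∀ b → (suc c <ᵇ z) ≡ b →
      All (λ ws → lrmaxFrom (suc c) (z ∷ ws) ≡ lrmaxFrom (suc c) (z ∷ zs)) (insertAllButLast 1 zs)
    after-z true  eq rewrite eq = All.map (cong suc) (lrmaxFrom-insertAllButLast z zs pz ps)
    after-z false eq rewrite eq = lrmaxFrom-insertAllButLast (suc c) zs (s≤s z≤n) ps

  rlmax-insertAllButLast : ∀ zs → All (2 ≤_) zs →
    All (λ ys → rlmax ys ≡ rlmax zs × maximum ys ≡ maximum zs) (insertAllButLast 1 zs)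
  rlmax-insertAllButLast []       _          = []
  rlmax-insertAllButLast (z ∷ zs) (2≤z ∷ ps) =
    (rlmax-1∷ z zs 2≤z , m≤n⇒m⊔n≡n (1≤maximum z zs 2≤z)) ∷
    All.map⁺ (All.map (λ {ws} → prepend-z {ws}) (rlmax-insertAllButLast zs ps))
    where
    prepend-z : ∀ {ws} → rlmax ws ≡ rlmax zs × maximum ws ≡ maximum zs →
      rlmax (z ∷ ws) ≡ rlmax (z ∷ zs) × maximum (z ∷ ws) ≡ maximum (z ∷ zs)
    prepend-z (eq₁ , eq₂) rewrite eq₁ | eq₂ = refl , refl

  lrmaxFrom-∷ʳ1 : ∀ c zs → 1 ≤ c → All (1 ≤_) zs → lrmaxFrom c (zs ∷ʳ 1) ≡ lrmaxFrom c zs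
  lrmaxFrom-∷ʳ1 (suc c) []       _ _          = refl
  lrmaxFrom-∷ʳ1 (suc c) (z ∷ zs) p (pz ∷ ps) with suc c <ᵇ z
  ... | true  = cong suc (lrmaxFrom-∷ʳ1 z zs pz ps)
  ... | false = lrmaxFrom-∷ʳ1 (suc c) zs p ps

  rlmax-∷ʳ1 : ∀ zs → All (2 ≤_) zs → rlmax (zs ∷ʳ 1) ≡ suc (rlmax zs)
  rlmax-∷ʳ1 []                 _                     = refl
  rlmax-∷ʳ1 (suc (suc k) ∷ zs) (s≤s (s≤s z≤n) ∷ ps) rewrite maximum-++ zs (1 ∷ []) | rlmax-∷ʳ1 zs ps with maximum zs
  ... | zero  = refl
  ... | suc m rewrite ⊔-identityʳ m with m <ᵇ suc k
  ...   | true  = refl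
  ...   | false = refl

  PositiveDistinct : ℕ → List ℕ → Set
  PositiveDistinct p []       = ⊤
  PositiveDistinct p (x ∷ xs) = 1 ≤ x × p ≢ x × PositiveDistinct x xs

  PositiveDistinct-map-suc : ∀ p τ → PositiveDistinct p τ → PositiveDistinct (suc p) (map suc τ)
  PositiveDistinct-map-suc p []      _                = tt
  PositiveDistinct-map-suc p (t ∷ τ) (1≤t , p≢t , pd) =
    s≤s z≤n , (λ eq → p≢t (suc-injective eq)) , PositiveDistinct-map-suc t τ pd

  PositiveDistinct⇒positive : ∀ p τ → PositiveDistinct p τ → All (1 ≤_) τ
  PositiveDistinct⇒positive p []      _              = []
  PositiveDistinct⇒positive p (t ∷ τ) (1≤t , _ , pd) = 1≤t ∷ PositiveDistinct⇒positive t τ pd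

  map-suc-≥2 : ∀ {τ} → All (1 ≤_) τ → All (2 ≤_) (map suc τ)
  map-suc-≥2 []       = []
  map-suc-≥2 (p ∷ ps) = s≤s p ∷ map-suc-≥2 ps

  ≥2⇒≥1 : ∀ {τ} → All (2 ≤_) τ → All (1 ≤_) τ
  ≥2⇒≥1 = All.map (≤-trans (s≤s z≤n))

  PositiveDistinct-from0 : ∀ p τ → PositiveDistinct p τ → PositiveDistinct 0 τ
  PositiveDistinct-from0 p []          _              = tt
  PositiveDistinct-from0 p (suc t ∷ τ) (1≤t , _ , pd) = 1≤t , (λ ()) , pd

  insertAll1-PositiveDistinct : ∀ p zs → p ≢ 1 → All (2 ≤_) zs → PositiveDistinct p zs →
    All (PositiveDistinct p) (insertAll 1 zs)
  insertAll1-PositiveDistinct p []       p≢1 _          _                = (s≤s z≤n , p≢1 , tt) ∷ []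
  insertAll1-PositiveDistinct p (z ∷ zs) p≢1 (2≤z ∷ ps) (1≤z , p≢z , pd) =
    (s≤s z≤n , p≢1 , 1≤z , 1≢z , pd) ∷
    All.map⁺ (All.map (λ pd′ → 1≤z , p≢z , pd′) (insertAll1-PositiveDistinct z zs z≢1 ps pd))
    where
    z≢1 : z ≢ 1
    z≢1 refl = <-irrefl refl 2≤z
    1≢z : 1 ≢ z
    1≢z = ≢-sym z≢1

  insertAll-nonempty : ∀ x zs → All (_≢ []) (insertAll x zs)
  insertAll-nonempty x []       = (λ ()) ∷ []
  insertAll-nonempty x (z ∷ zs) = (λ ()) ∷ All.map⁺ (All.universal (λ _ ()) (insertAll x zs))

  S′-PositiveDistinct : ∀ m → All (PositiveDistinct 0) (S′ m)
  S′-PositiveDistinct zero    = tt ∷ []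
  S′-PositiveDistinct (suc m) = All.concat⁺ (All.map⁺ (All.map (λ {τ} pd → insert1 τ pd) (S′-PositiveDistinct m)))
    where
    insert1 : ∀ τ → PositiveDistinct 0 τ → All (PositiveDistinct 0) (insertAll 1 (map suc τ))
    insert1 τ pd = insertAll1-PositiveDistinct 0 (map suc τ) (λ ()) (map-suc-≥2 (PositiveDistinct⇒positive 0 τ pd))
                     (PositiveDistinct-from0 1 (map suc τ) (PositiveDistinct-map-suc 0 τ pd))

  S′-nonempty : ∀ m → All (_≢ []) (S′ (suc m))
  S′-nonempty m = All.concat⁺ (All.map⁺ (All.universal (λ τ → insertAll-nonempty 1 (map suc τ)) (S′ m)))

  head₀ : List ℕ → ℕ
  head₀ []      = 0
  head₀ (x ∷ _) = x

  head₀-map-suc : ∀ z zs → (suc z <ᵇ head₀ (map suc zs)) ≡ (z <ᵇ head₀ zs)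
  head₀-map-suc z []      = refl
  head₀-map-suc z (_ ∷ _) = refl

open Permutations

module ListSum {c ℓ} (R : CommutativeRing c ℓ) where
  open CommutativeRing R
  open import Relation.Binary.Reasoning.Setoid setoid

  ∑ : ∀ {A : Set} → List A → (A → Carrier) → Carrier
  ∑ X f = sumList R (map f X)

  infix 5 ∑
  syntax ∑ X (λ x → e) = ∑[ x ∈ X ] e

  ∑-cong : ∀ {A : Set} (X : List A) {f g : A → Carrier} → (∀ a → f a ≈ g a) → ∑ X f ≈ ∑ X g
  ∑-cong []      f≈g = refl
  ∑-cong (a ∷ X) f≈g = +-cong (f≈g a) (∑-cong X f≈g)

  ∑-congᴬ : ∀ {A : Set} {X : List A} {f g : A → Carrier} → All (λ a → f a ≈ g a) X → ∑ X f ≈ ∑ X g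
  ∑-congᴬ []           = refl
  ∑-congᴬ (fa≈ga ∷ ps) = +-cong fa≈ga (∑-congᴬ ps)

  ∑-++ : ∀ {A : Set} (X Y : List A) (f : A → Carrier) → ∑ (X ++ Y) f ≈ ∑ X f + ∑ Y f
  ∑-++ []      Y f = sym (+-identityˡ _)
  ∑-++ (a ∷ X) Y f = trans (+-congˡ (∑-++ X Y f)) (sym (+-assoc _ _ _))

  ∑-concatMap : ∀ {A B : Set} (g : A → List B) (X : List A) (f : B → Carrier) →
    ∑ (concatMap g X) f ≈ ∑[ a ∈ X ] ∑ (g a) f
  ∑-concatMap g []      f = refl
  ∑-concatMap g (a ∷ X) f = trans (∑-++ (g a) (concatMap g X) f) (+-congˡ (∑-concatMap g X f))

  ∑-map : ∀ {A B : Set} (g : A → B) (X : List A) (f : B → Carrier) → ∑ (map g X) f ≡ ∑[ a ∈ X ] f (g a)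
  ∑-map g X f = ≡.cong (sumList R) (≡.sym (List.map-∘ X))

  ∑-distribˡ : ∀ {A : Set} (X : List A) k (f : A → Carrier) → ∑[ a ∈ X ] k * f a ≈ k * ∑ X f
  ∑-distribˡ []      k f = sym (zeroʳ k)
  ∑-distribˡ (a ∷ X) k f = trans (+-congˡ (∑-distribˡ X k f)) (sym (distribˡ _ _ _))

  ∑-distribʳ : ∀ {A : Set} (X : List A) k (f : A → Carrier) → ∑[ a ∈ X ] f a * k ≈ ∑ X f * k
  ∑-distribʳ X k f = trans (∑-cong X (λ a → *-comm (f a) k)) (trans (∑-distribˡ X k f) (*-comm k (∑ X f)))

  ∑-+ : ∀ {A : Set} (X : List A) (f g : A → Carrier) → ∑[ a ∈ X ] (f a + g a) ≈ ∑ X f + ∑ X g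
  ∑-+ []      f g = sym (+-identityˡ _)
  ∑-+ (a ∷ X) f g = trans (+-congˡ (∑-+ X f g)) (interchange (f a) (g a) (∑ X f) (∑ X g))
    where open import Algebra.Properties.CommutativeSemigroup +-commutativeSemigroup using (interchange)

  ∑-insertAll-comm : ∀ x y L (f : List ℕ → Carrier) →
    ∑[ σ ∈ insertAll x L ] ∑ (insertAll y σ) f ≈ ∑[ σ ∈ insertAll y L ] ∑ (insertAll x σ) f
  ∑-insertAll-comm x y []       f = begin
    (f (y ∷ x ∷ []) + (f (x ∷ y ∷ []) + 0#)) + 0# ≈⟨ +-identityʳ _ ⟩
    f (y ∷ x ∷ []) + (f (x ∷ y ∷ []) + 0#)        ≈⟨ +-comm _ _ ⟩
    (f (x ∷ y ∷ []) + 0#) + f (y ∷ x ∷ [])        ≈⟨ +-congʳ (+-identityʳ _) ⟩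
    f (x ∷ y ∷ []) + f (y ∷ x ∷ [])               ≈⟨ +-congˡ (+-identityʳ _) ⟨
    f (x ∷ y ∷ []) + (f (y ∷ x ∷ []) + 0#)        ≈⟨ +-identityʳ _ ⟨
    (f (x ∷ y ∷ []) + (f (y ∷ x ∷ []) + 0#)) + 0# ∎
  ∑-insertAll-comm x y (t ∷ ts) f = begin
    lhs x y                                         ≈⟨ expand x y ⟩
    (f (y ∷ x ∷ L) + f (x ∷ y ∷ L)) + ((after y x + after x y) + twice x y)
      ≈⟨ +-cong (+-comm _ _) (+-cong (+-comm _ _) (∑-insertAll-comm x y ts (λ σ → f (t ∷ σ)))) ⟩
    (f (x ∷ y ∷ L) + f (y ∷ x ∷ L)) + ((after x y + after y x) + twice y x)
                                                    ≈⟨ expand y x ⟨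
    lhs y x                                         ∎
    where
    L : List ℕ
    L = t ∷ ts
    lhs : ℕ → ℕ → Carrier
    lhs x y = ∑[ σ ∈ insertAll x L ] ∑ (insertAll y σ) f
    after : ℕ → ℕ → Carrier
    after x y = ∑[ σ ∈ insertAll x ts ] f (y ∷ t ∷ σ)
    twice : ℕ → ℕ → Carrier
    twice x y = ∑[ σ ∈ insertAll x ts ] ∑[ ρ ∈ insertAll y σ ] f (t ∷ ρ)
    expand : ∀ x y → lhs x y ≈ (f (y ∷ x ∷ L) + f (x ∷ y ∷ L)) + ((after y x + after x y) + twice x y)
    expand x y = begin
      ∑ (insertAll y (x ∷ L)) f + ∑ (map (t ∷_) (insertAll x ts)) (λ σ → ∑ (insertAll y σ) f)
        ≡⟨ ≡.cong₂ (λ p q → f (y ∷ x ∷ L) + (f (x ∷ y ∷ L) + p) + q)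
                   (≡.trans (∑-map (x ∷_) (map (t ∷_) (insertAll y ts)) f) (∑-map (t ∷_) (insertAll y ts) _))
                   (∑-map (t ∷_) (insertAll x ts) _) ⟩
      f (y ∷ x ∷ L) + (f (x ∷ y ∷ L) + after y x)
        + (∑[ σ ∈ insertAll x ts ] (f (y ∷ t ∷ σ) + ∑ (map (t ∷_) (insertAll y σ)) f))
        ≈⟨ +-cong (sym (+-assoc _ _ _))
                  (trans (∑-cong (insertAll x ts) (λ σ → +-congˡ (reflexive (∑-map (t ∷_) (insertAll y σ) f))))
                         (∑-+ (insertAll x ts) _ _)) ⟩
      (f (y ∷ x ∷ L) + f (x ∷ y ∷ L) + after y x) + (after x y + twice x y)
        ≈⟨ trans (+-assoc _ _ _) (+-congˡ (sym (+-assoc _ _ _))) ⟩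
      (f (y ∷ x ∷ L) + f (x ∷ y ∷ L)) + ((after y x + after x y) + twice x y) ∎

  ∑-S≈∑-S′ : ∀ m (f : List ℕ → Carrier) → ∑ (S m) f ≈ ∑ (S′ m) f
  ∑-S≈∑-S′ zero          f = refl
  ∑-S≈∑-S′ (suc zero)    f = refl
  ∑-S≈∑-S′ (suc (suc k)) f = begin
    ∑ (concatMap (insertAll (2 ℕ.+ k)) (S (suc k))) f   ≈⟨ ∑-concatMap _ (S (suc k)) f ⟩
    ∑ (S (suc k)) insertMax                               ≈⟨ ∑-S≈∑-S′ (suc k) insertMax ⟩
    ∑ (concatMap insert1 (S′ k)) insertMax                ≈⟨ ∑-concatMap insert1 (S′ k) insertMax ⟩
    ∑[ τ ∈ S′ k ] ∑ (insert1 τ) insertMax                 ≈⟨ ∑-cong (S′ k) insertions-commute ⟩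
    ∑[ τ ∈ S′ k ] ∑ (insertAll (suc k) τ) insertMin       ≈⟨ ∑-S≈∑-S′ k _ ⟨
    ∑[ τ ∈ S k ] ∑ (insertAll (suc k) τ) insertMin        ≈⟨ ∑-concatMap (insertAll (suc k)) (S k) insertMin ⟨
    ∑ (S (suc k)) insertMin                               ≈⟨ ∑-S≈∑-S′ (suc k) insertMin ⟩
    ∑ (S′ (suc k)) insertMin                              ≈⟨ ∑-concatMap insert1 (S′ (suc k)) f ⟨
    ∑ (S′ (suc (suc k))) f                                ∎
    where
    insert1 : List ℕ → List (List ℕ)
    insert1 τ = insertAll 1 (map suc τ)
    insertMax insertMin : List ℕ → Carrier
    insertMax σ = ∑ (insertAll (2 ℕ.+ k) σ) f
    insertMin σ = ∑ (insert1 σ) f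
    insertions-commute : ∀ τ → ∑ (insert1 τ) insertMax ≈ ∑ (insertAll (suc k) τ) insertMin
    insertions-commute τ = begin
      ∑ (insertAll 1 (map suc τ)) insertMax                         ≈⟨ ∑-insertAll-comm 1 (2 ℕ.+ k) (map suc τ) f ⟩
      ∑[ σ ∈ insertAll (2 ℕ.+ k) (map suc τ) ] ∑ (insertAll 1 σ) f
        ≡⟨ ≡.cong (λ X → ∑[ σ ∈ X ] ∑ (insertAll 1 σ) f) (map-suc-insertAll (suc k) τ) ⟨
      ∑[ σ ∈ map (map suc) (insertAll (suc k) τ) ] ∑ (insertAll 1 σ) f ≡⟨ ∑-map (map suc) (insertAll (suc k) τ) _ ⟩
      ∑ (insertAll (suc k) τ) insertMin                              ∎

module Weight {c ℓ} (R : CommutativeRing c ℓ) (α β u₁ u₂ u₃ u₄ : CommutativeRing.Carrier R) where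
  open CommutativeRing R
  open IntegerCoefficients R
  open ListSum R
  open import Relation.Binary.Reasoning.Setoid setoid

  v y c₁ c₂ : Carrier
  v  = u₁ * u₂
  y  = α * u₄ + β * u₃
  c₁ = y + y + (u₃ + u₄)
  c₂ = y * y + y * (u₃ + u₄) + v

  -- The weight of a letter, given (predecessor < letter) and (letter < successor):
  -- double ascent u₄, peak 1, valley u₁u₂ (as W = V + 1), double descent u₃.
  letter : Bool → Bool → Carrier
  letter true  true  = u₄
  letter true  false = 1#
  letter false true  = v
  letter false false = u₃

  -- Change of the weight when a new minimum is inserted right before / right after
  -- the letter.  Their sum is the derivative of the letter weight along
  -- u₁ ↦ (u₃ + u₄) u₁, u₃ ↦ v, u₄ ↦ v.
  gainBefore gainAfter letter′ : Bool → Bool → Carrier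
  gainBefore true  _     = 0#
  gainBefore false true  = v * u₄
  gainBefore false false = v
  gainAfter  _     false = 0#
  gainAfter  true  true  = v
  gainAfter  false true  = v * u₃
  letter′ A B = gainBefore A B + gainAfter A B

  letterAt : ℕ → ℕ → ℕ → Carrier
  letterAt p x q = letter (p <ᵇ x) (x <ᵇ q)

  weight weight′ : ℕ → List ℕ → Carrier
  weight  p []       = 1#
  weight  p (x ∷ xs) = letterAt p x (head₀ xs) * weight x xs
  weight′ p []       = 0#
  weight′ p (x ∷ xs) = letter′ (p <ᵇ x) (x <ᵇ head₀ xs) * weight x xs + letterAt p x (head₀ xs) * weight′ x xs

  maxWeight : List ℕ → Carrier
  maxWeight σ = pow R α (LRmax σ ∸ 1) * pow R β (rlmax σ ∸ 1)

  totalWeight : List ℕ → Carrier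
  totalWeight σ = weight 0 σ * maxWeight σ

  Q Q′ : ℕ → Carrier
  Q  m = ∑ (S′ m) totalWeight
  Q′ m = ∑[ σ ∈ S′ m ] maxWeight σ * weight′ 0 σ

  weight-map-suc : ∀ p zs → weight (suc p) (map suc zs) ≡ weight p zs
  weight-map-suc p []       = ≡.refl
  weight-map-suc p (z ∷ zs) = ≡.cong₂ _*_ (≡.cong (letter (p <ᵇ z)) (head₀-map-suc z zs)) (weight-map-suc z zs)

  weight′-map-suc : ∀ p zs → weight′ (suc p) (map suc zs) ≡ weight′ p zs
  weight′-map-suc p []       = ≡.refl
  weight′-map-suc p (z ∷ zs) rewrite head₀-map-suc z zs | weight-map-suc z zs | weight′-map-suc z zs = ≡.refl

  weight-∷ʳ1 : ∀ p x zs → 2 ≤ x → All (2 ≤_) zs → weight p (x ∷ zs ∷ʳ 1) ≈ weight p (x ∷ zs) * u₃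
  weight-∷ʳ1 p (suc (suc k)) []       (s≤s (s≤s z≤n)) _ = trans (*-congˡ (*-identityʳ u₃)) (sym (*-congʳ (*-identityʳ _)))
  weight-∷ʳ1 p x@(suc (suc k)) (z ∷ zs) (s≤s (s≤s z≤n)) (2≤z ∷ ps) =
    trans (*-congˡ (weight-∷ʳ1 x z zs 2≤z ps)) (sym (*-assoc _ _ _))

  -- Leibniz rule at the gap between two letters of types (A, B) and (B, C).
  gain-at-gap : ∀ A B C → letter A false * v * letter true C ≈ gainAfter A B * letter B C + letter A B * gainBefore B C
  gain-at-gap A true C = begin
    letter A false * v * letter true C          ≈⟨ *-congʳ (after A) ⟩
    gainAfter A true * letter true C            ≈⟨ +-identityʳ _ ⟨
    gainAfter A true * letter true C + 0#       ≈⟨ +-congˡ (zeroʳ _) ⟨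
    gainAfter A true * letter true C + letter A true * 0# ∎
    where
    after : ∀ A → letter A false * v ≈ gainAfter A true
    after true  = *-identityˡ v
    after false = *-comm u₃ v
  gain-at-gap A false C = begin
    letter A false * v * letter true C          ≈⟨ *-assoc _ _ _ ⟩
    letter A false * (v * letter true C)        ≈⟨ *-congˡ (before C) ⟩
    letter A false * gainBefore false C         ≈⟨ +-identityˡ _ ⟨
    0# + letter A false * gainBefore false C    ≈⟨ +-congʳ (zeroˡ _) ⟨
    0# * letter false C + letter A false * gainBefore false C ∎
    where
    before : ∀ C → v * letter true C ≈ gainBefore false C
    before true  = refl
    before false = *-identityʳ v

  ∑-insertAllButLast-weight : ∀ p x xs → 2 ≤ x → All (2 ≤_) xs →
    ∑[ ys ∈ insertAllButLast 1 xs ] weight p (x ∷ ys)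
      ≈ gainAfter (p <ᵇ x) (x <ᵇ head₀ xs) * weight x xs + letterAt p x (head₀ xs) * weight′ x xs
  ∑-insertAllButLast-weight p (suc (suc k)) [] (s≤s (s≤s z≤n)) _ = sym (trans (+-cong (zeroˡ _) (zeroʳ _)) (+-identityˡ 0#))
  ∑-insertAllButLast-weight p x@(suc (suc _)) (z@(suc (suc _)) ∷ zs) (s≤s (s≤s z≤n)) (2≤z@(s≤s (s≤s z≤n)) ∷ ps) = begin
    LA₀ * (v * (L₁C * w)) + ∑ (map (z ∷_) (insertAllButLast 1 zs)) (λ ys → weight p (x ∷ ys))
      ≡⟨ ≡.cong (_+_ (LA₀ * (v * (L₁C * w)))) (∑-map (z ∷_) (insertAllButLast 1 zs) _) ⟩
    LA₀ * (v * (L₁C * w)) + (∑[ ws ∈ insertAllButLast 1 zs ] LAB * weight x (z ∷ ws))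
      ≈⟨ +-congˡ (trans (∑-distribˡ (insertAllButLast 1 zs) LAB _) (*-congˡ (∑-insertAllButLast-weight x z zs 2≤z ps))) ⟩
    LA₀ * (v * (L₁C * w)) + LAB * (gainAfter B C * w + LBC * w′)
      ≈⟨ solve 8 (λ a v l w b g k d → a :* (v :* (l :* w)) :+ b :* (g :* w :+ k :* d)
                                    := (a :* v :* l) :* w :+ b :* (g :* w :+ k :* d)) refl LA₀ v L₁C w LAB (gainAfter B C) LBC w′ ⟩
    (LA₀ * v * L₁C) * w + LAB * (gainAfter B C * w + LBC * w′)
      ≈⟨ +-congʳ (*-congʳ (gain-at-gap A B C)) ⟩
    (gainAfter A B * LBC + LAB * gainBefore B C) * w + LAB * (gainAfter B C * w + LBC * w′)
      ≈⟨ solve 7 (λ h k b g g′ w d → (h :* k :+ b :* g) :* w :+ b :* (g′ :* w :+ k :* d)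
                                  := h :* (k :* w) :+ b :* ((g :+ g′) :* w :+ k :* d)) refl
                 (gainAfter A B) LBC LAB (gainBefore B C) (gainAfter B C) w w′ ⟩
    gainAfter A B * weight x (z ∷ zs) + LAB * weight′ x (z ∷ zs) ∎
    where
    A B C : Bool
    A = p <ᵇ x
    B = x <ᵇ z
    C = z <ᵇ head₀ zs
    w w′ LA₀ L₁C LAB LBC : Carrier
    w   = weight z zs
    w′  = weight′ z zs
    LA₀ = letter A false
    L₁C = letter true C
    LAB = letter A B
    LBC = letter B C

  module _ (t : ℕ) (ts : List ℕ) (ts≥1 : All (1 ≤_) ts) where
    private
      τ xs : List ℕ
      τ  = suc t ∷ ts
      xs = map suc ts
      x : ℕ
      x = suc (suc t)
      xs≥2 : All (2 ≤_) xs
      xs≥2 = map-suc-≥2 ts≥1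
      a b : Carrier
      a = pow R α (LRmax τ ∸ 1)
      b = pow R β (rlmax τ ∸ 1)
      lrmax-shift : lrmaxFrom x xs ≡ lrmaxFrom (suc t) ts
      lrmax-shift = lrmaxFrom-map-suc (suc t) ts
      rlmax-shift : rlmax (x ∷ xs) ≡ rlmax τ
      rlmax-shift = rlmax-map-suc τ (s≤s z≤n ∷ ts≥1)

    totalWeight-insert1-front : totalWeight (1 ∷ x ∷ xs) ≈ (u₄ * weight 0 τ) * ((α * a) * b)
    totalWeight-insert1-front = reflexive (≡.cong₂ _*_ (≡.cong (u₄ *_) (weight-map-suc 0 τ)) (≡.cong₂ _*_
      (≡.cong (λ n → pow R α (suc n)) lrmax-shift)
      (≡.cong (λ n → pow R β (n ∸ 1)) (≡.trans (rlmax-1∷ x xs (s≤s (s≤s z≤n))) rlmax-shift))))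

    totalWeight-insert1-end : totalWeight (x ∷ xs ∷ʳ 1) ≈ (weight 0 τ * u₃) * (a * (β * b))
    totalWeight-insert1-end = *-cong
      (trans (weight-∷ʳ1 0 x xs (s≤s (s≤s z≤n)) xs≥2) (*-congʳ (reflexive (weight-map-suc 0 τ))))
      (reflexive (≡.cong₂ _*_
        (≡.cong (pow R α) (≡.trans (lrmaxFrom-∷ʳ1 x xs (s≤s z≤n) (≥2⇒≥1 xs≥2)) lrmax-shift))
        (≡.cong (λ n → pow R β (n ∸ 1)) (≡.trans (rlmax-∷ʳ1 (x ∷ xs) (s≤s (s≤s z≤n) ∷ xs≥2))
                                                  (≡.cong suc (≡.trans rlmax-shift rlmax-τ≡1+))))))
      where
      rlmax-τ≡1+ : rlmax τ ≡ suc (rlmax τ ∸ 1)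
      rlmax-τ≡1+ with rlmax τ | rlmax-positive (suc t) ts (s≤s z≤n ∷ ts≥1)
      ... | suc r | _ = ≡.refl

    maxWeight-insert1-inside : All (λ ys → maxWeight (x ∷ ys) ≡ maxWeight τ) (insertAllButLast 1 xs)
    maxWeight-insert1-inside = All.zipWith (λ {ys} → both-unchanged {ys})
      (lrmaxFrom-insertAllButLast x xs (s≤s z≤n) (≥2⇒≥1 xs≥2) , rlmax-insertAllButLast xs xs≥2)
      where
      both-unchanged : ∀ {ys} → lrmaxFrom x ys ≡ lrmaxFrom x xs × (rlmax ys ≡ rlmax xs × maximum ys ≡ maximum xs) →
                       maxWeight (x ∷ ys) ≡ maxWeight τ
      both-unchanged (lr , rl , max) = ≡.cong₂ _*_ (≡.cong (pow R α) (≡.trans lr lrmax-shift))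
        (≡.cong (λ n → pow R β (n ∸ 1)) (≡.trans (≡.cong₂ (λ m r → if m <ᵇ x then suc r else r) max rl) rlmax-shift))

    ∑-totalWeight-insert1-inside : ∑ (map (x ∷_) (insertAllButLast 1 xs)) totalWeight ≈ weight′ 0 τ * maxWeight τ
    ∑-totalWeight-insert1-inside = begin
      ∑ (map (x ∷_) (insertAllButLast 1 xs)) totalWeight              ≡⟨ ∑-map (x ∷_) (insertAllButLast 1 xs) totalWeight ⟩
      ∑[ ys ∈ insertAllButLast 1 xs ] weight 0 (x ∷ ys) * maxWeight (x ∷ ys)
        ≈⟨ ∑-congᴬ (All.map (λ eq → *-congˡ (reflexive eq)) maxWeight-insert1-inside) ⟩
      ∑[ ys ∈ insertAllButLast 1 xs ] weight 0 (x ∷ ys) * maxWeight τ ≈⟨ ∑-distribʳ (insertAllButLast 1 xs) (maxWeight τ) _ ⟩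
      (∑[ ys ∈ insertAllButLast 1 xs ] weight 0 (x ∷ ys)) * maxWeight τ
        ≈⟨ *-congʳ (∑-insertAllButLast-weight 0 x xs (s≤s (s≤s z≤n)) xs≥2) ⟩
      (gainAfter true (x <ᵇ head₀ xs) * weight x xs + letterAt 0 x (head₀ xs) * weight′ x xs) * maxWeight τ
        ≈⟨ *-congʳ (+-congʳ (*-congʳ (+-identityˡ _))) ⟨
      weight′ 0 (x ∷ xs) * maxWeight τ                                 ≡⟨ ≡.cong (_* maxWeight τ) (weight′-map-suc 0 τ) ⟩
      weight′ 0 τ * maxWeight τ                                        ∎

    ∑-insert1 : ∑ (insertAll 1 (map suc τ)) totalWeight ≈ y * totalWeight τ + maxWeight τ * weight′ 0 τ
    ∑-insert1 = begin
      totalWeight (1 ∷ x ∷ xs) + ∑ (map (x ∷_) (insertAll 1 xs)) totalWeight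
        ≡⟨ ≡.cong (λ X → totalWeight (1 ∷ x ∷ xs) + ∑ X totalWeight)
                  (≡.trans (≡.cong (map (x ∷_)) (insertAll≡insertAllButLast++∷ʳ 1 xs))
                           (List.map-++ (x ∷_) (insertAllButLast 1 xs) _)) ⟩
      totalWeight (1 ∷ x ∷ xs) + ∑ (map (x ∷_) (insertAllButLast 1 xs) ∷ʳ (x ∷ xs ∷ʳ 1)) totalWeight
        ≈⟨ +-congˡ (∑-++ (map (x ∷_) (insertAllButLast 1 xs)) _ totalWeight) ⟩
      totalWeight (1 ∷ x ∷ xs) + (∑ (map (x ∷_) (insertAllButLast 1 xs)) totalWeight + (totalWeight (x ∷ xs ∷ʳ 1) + 0#))
        ≈⟨ +-cong totalWeight-insert1-front (+-cong ∑-totalWeight-insert1-inside (+-congʳ totalWeight-insert1-end)) ⟩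
      (u₄ * w) * ((α * a) * b) + (w′ * (a * b) + ((w * u₃) * (a * (β * b)) + 0#))
        ≈⟨ solve 8 (λ u₄ w α a b w′ u₃ β →
                     (u₄ :* w) :* ((α :* a) :* b) :+ (w′ :* (a :* b) :+ ((w :* u₃) :* (a :* (β :* b)) :+ :0))
                     := (α :* u₄ :+ β :* u₃) :* (w :* (a :* b)) :+ (a :* b) :* w′) refl u₄ w α a b w′ u₃ β ⟩
      y * (w * (a * b)) + (a * b) * w′ ∎
      where
      w w′ : Carrier
      w  = weight 0 τ
      w′ = weight′ 0 τ

  Q-step : ∀ m → Q (2 ℕ.+ m) ≈ y * Q (suc m) + Q′ (suc m)
  Q-step m = begin
    ∑ (concatMap insert1 (S′ (suc m))) totalWeight              ≈⟨ ∑-concatMap insert1 (S′ (suc m)) totalWeight ⟩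
    ∑[ σ ∈ S′ (suc m) ] ∑ (insert1 σ) totalWeight               ≈⟨ ∑-congᴬ (All.zipWith (λ {σ} (ne , pd) → step σ ne pd)
                                                                         (S′-nonempty m , S′-PositiveDistinct (suc m))) ⟩
    ∑[ σ ∈ S′ (suc m) ] (y * totalWeight σ + maxWeight σ * weight′ 0 σ) ≈⟨ ∑-+ (S′ (suc m)) _ _ ⟩
    (∑[ σ ∈ S′ (suc m) ] y * totalWeight σ) + Q′ (suc m)        ≈⟨ +-congʳ (∑-distribˡ (S′ (suc m)) y totalWeight) ⟩
    y * Q (suc m) + Q′ (suc m)                                  ∎
    where
    insert1 : List ℕ → List (List ℕ)
    insert1 τ = insertAll 1 (map suc τ)
    step : ∀ σ → σ ≢ [] → PositiveDistinct 0 σ → ∑ (insert1 σ) totalWeight ≈ y * totalWeight σ + maxWeight σ * weight′ 0 σ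
    step []            ne _ = ⊥-elim (ne ≡.refl)
    step (suc t ∷ ts) _  (_ , _ , pd) = ∑-insert1 t ts (PositiveDistinct⇒positive (suc t) ts pd)

  Q-one : Q 1 ≈ 1#
  Q-one = trans (+-identityʳ _) (trans (*-cong (*-identityʳ 1#) (*-identityʳ 1#)) (*-identityʳ 1#))

  Q′-one : Q′ 1 ≈ 0#
  Q′-one = trans (+-identityʳ _) (trans (*-congˡ weight′-[1]) (zeroʳ _))
    where
    weight′-[1] : weight′ 0 (1 ∷ []) ≈ 0#
    weight′-[1] = trans (+-cong (trans (*-congʳ (+-identityʳ 0#)) (zeroˡ 1#)) (zeroʳ 1#)) (+-identityʳ 0#)

  Q-two : Q 2 ≈ y
  Q-two = trans (Q-step 0) (trans (+-cong (trans (*-congˡ Q-one) (*-identityʳ _)) Q′-one) (+-identityʳ _))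

-- Weights over R[ε] after moving u₁ ↦ u₁ + ε (u₃ + u₄) u₁, u₃ ↦ u₃ + ε v, u₄ ↦ u₄ + ε v:
-- the ε-parts are the derivatives weight′ and Q′.
module Lift {c ℓ} (R : CommutativeRing c ℓ) (α β u₁ u₂ u₃ u₄ : CommutativeRing.Carrier R) where
  open CommutativeRing R
  open IntegerCoefficients R
  open ListSum R
  open Weight R α β u₁ u₂ u₃ u₄
  open import Relation.Binary.Reasoning.Setoid setoid

  α̃ β̃ ũ₁ ũ₂ ũ₃ ũ₄ : DualNumbers.Dual R
  α̃  = α , 0#
  β̃  = β , 0#
  ũ₁ = u₁ , (u₃ + u₄) * u₁
  ũ₂ = u₂ , 0#
  ũ₃ = u₃ , v
  ũ₄ = u₄ , v

  module ε = Weight (R [ε]) α̃ β̃ ũ₁ ũ₂ ũ₃ ũ₄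
  module ∑ε = ListSum (R [ε])

  letter-lift₁ : ∀ A B → proj₁ (ε.letter A B) ≈ letter A B
  letter-lift₁ true  true  = refl
  letter-lift₁ true  false = refl
  letter-lift₁ false true  = refl
  letter-lift₁ false false = refl

  letter-lift₂ : ∀ A B → proj₂ (ε.letter A B) ≈ letter′ A B
  letter-lift₂ true  true  = sym (+-identityˡ v)
  letter-lift₂ true  false = sym (+-identityˡ 0#)
  letter-lift₂ false true  = solve 4 (λ u₁ u₂ u₃ u₄ → u₁ :* :0 :+ ((u₃ :+ u₄) :* u₁) :* u₂
                                                   := (u₁ :* u₂) :* u₄ :+ (u₁ :* u₂) :* u₃) refl u₁ u₂ u₃ u₄
  letter-lift₂ false false = sym (+-identityʳ v)

  weight-lift₁ : ∀ p σ → proj₁ (ε.weight p σ) ≈ weight p σ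
  weight-lift₁ p []       = refl
  weight-lift₁ p (x ∷ xs) = *-cong (letter-lift₁ (p <ᵇ x) (x <ᵇ head₀ xs)) (weight-lift₁ x xs)

  weight-lift₂ : ∀ p σ → proj₂ (ε.weight p σ) ≈ weight′ p σ
  weight-lift₂ p []       = refl
  weight-lift₂ p (x ∷ xs) = trans (+-cong (*-cong (letter-lift₁ A B) (weight-lift₂ x xs))
                                          (*-cong (letter-lift₂ A B) (weight-lift₁ x xs)))
                                  (+-comm _ _)
    where
    A B : Bool
    A = p <ᵇ x
    B = x <ᵇ head₀ xs

  pow-lift₁ : ∀ z n → proj₁ (pow (R [ε]) (z , 0#) n) ≈ pow R z n
  pow-lift₁ z zero    = refl
  pow-lift₁ z (suc n) = *-congˡ (pow-lift₁ z n)

  pow-lift₂ : ∀ z n → proj₂ (pow (R [ε]) (z , 0#) n) ≈ 0#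
  pow-lift₂ z zero    = refl
  pow-lift₂ z (suc n) = trans (+-cong (trans (*-congˡ (pow-lift₂ z n)) (zeroʳ z)) (zeroˡ _)) (+-identityʳ 0#)

  maxWeight-lift₁ : ∀ σ → proj₁ (ε.maxWeight σ) ≈ maxWeight σ
  maxWeight-lift₁ σ = *-cong (pow-lift₁ α (LRmax σ ∸ 1)) (pow-lift₁ β (rlmax σ ∸ 1))

  maxWeight-lift₂ : ∀ σ → proj₂ (ε.maxWeight σ) ≈ 0#
  maxWeight-lift₂ σ = trans (+-cong (trans (*-congˡ (pow-lift₂ β (rlmax σ ∸ 1))) (zeroʳ _))
                                    (trans (*-congʳ (pow-lift₂ α (LRmax σ ∸ 1))) (zeroˡ _)))
                            (+-identityʳ 0#)

  totalWeight-lift₁ : ∀ σ → proj₁ (ε.totalWeight σ) ≈ totalWeight σ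
  totalWeight-lift₁ σ = *-cong (weight-lift₁ 0 σ) (maxWeight-lift₁ σ)

  totalWeight-lift₂ : ∀ σ → proj₂ (ε.totalWeight σ) ≈ maxWeight σ * weight′ 0 σ
  totalWeight-lift₂ σ = begin
    proj₁ (ε.weight 0 σ) * proj₂ (ε.maxWeight σ) + proj₂ (ε.weight 0 σ) * proj₁ (ε.maxWeight σ)
      ≈⟨ +-cong (trans (*-congˡ (maxWeight-lift₂ σ)) (zeroʳ _)) (*-cong (weight-lift₂ 0 σ) (maxWeight-lift₁ σ)) ⟩
    0# + weight′ 0 σ * maxWeight σ ≈⟨ trans (+-identityˡ _) (*-comm _ _) ⟩
    maxWeight σ * weight′ 0 σ ∎

  ∑-lift₁ : ∀ X (f : List ℕ → DualNumbers.Dual R) → proj₁ (∑ε.∑ X f) ≈ ∑[ σ ∈ X ] proj₁ (f σ)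
  ∑-lift₁ []      f = refl
  ∑-lift₁ (σ ∷ X) f = +-congˡ (∑-lift₁ X f)

  ∑-lift₂ : ∀ X (f : List ℕ → DualNumbers.Dual R) → proj₂ (∑ε.∑ X f) ≈ ∑[ σ ∈ X ] proj₂ (f σ)
  ∑-lift₂ []      f = refl
  ∑-lift₂ (σ ∷ X) f = +-congˡ (∑-lift₂ X f)

  Q-lift₁ : ∀ m → proj₁ (ε.Q m) ≈ Q m
  Q-lift₁ m = trans (∑-lift₁ (S′ m) ε.totalWeight) (∑-cong (S′ m) totalWeight-lift₁)

  Q-lift₂ : ∀ m → proj₂ (ε.Q m) ≈ Q′ m
  Q-lift₂ m = trans (∑-lift₂ (S′ m) ε.totalWeight) (∑-cong (S′ m) totalWeight-lift₂)

  module _ (α+β≈-1 : α + β ≈ - 1#) where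
    open import Algebra.Properties.Ring ring using (-‿distribˡ-*)

    y-lift₂ : proj₂ ε.y ≈ - v
    y-lift₂ = begin
      (α * v + 0# * u₄) + (β * v + 0# * u₃) ≈⟨ solve 5 (λ α β v u₃ u₄ → (α :* v :+ :0 :* u₄) :+ (β :* v :+ :0 :* u₃)
                                                                  := (α :+ β) :* v) refl α β v u₃ u₄ ⟩
      (α + β) * v                          ≈⟨ *-congʳ α+β≈-1 ⟩
      - 1# * v                             ≈⟨ -‿distribˡ-* 1# v ⟨
      - (1# * v)                           ≈⟨ -‿cong (*-identityˡ v) ⟩
      - v                                  ∎

    Q′-two : Q′ 2 ≈ - v
    Q′-two = trans (sym (Q-lift₂ 2)) (trans (proj₂ (ε.Q-two)) y-lift₂)

    y-lift₂+v≈0 : proj₂ ε.y + v ≈ 0#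
    y-lift₂+v≈0 = trans (+-congʳ y-lift₂) (-‿inverseˡ v)

    c₁-lift₂ : proj₂ ε.c₁ ≈ 0#
    c₁-lift₂ = trans (solve 2 (λ y′ v → (y′ :+ y′) :+ (v :+ v) := (y′ :+ v) :* (:1 :+ :1)) refl (proj₂ ε.y) v)
                     (trans (*-congʳ y-lift₂+v≈0) (zeroˡ _))

    c₂-lift₂ : proj₂ ε.c₂ ≈ 0#
    c₂-lift₂ = trans (solve 6 (λ y y′ u₁ u₂ u₃ u₄ →
                          let v = u₁ :* u₂ ; s = u₃ :+ u₄ in
                          (y :* y′ :+ y′ :* y :+ (y :* (v :+ v) :+ y′ :* s)) :+ (u₁ :* :0 :+ (s :* u₁) :* u₂)
                          := (y′ :+ v) :* (y :+ y :+ s)) refl y (proj₂ ε.y) u₁ u₂ u₃ u₄)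
                     (trans (*-congʳ y-lift₂+v≈0) (zeroˡ _))

-- Stated for all rings at once, so that the induction hypothesis over R[ε] also gives the
-- recurrence for Q′ (the ε-parts of c₁ and c₂ vanish).
Q-recurrence : ∀ {c ℓ} (R : CommutativeRing c ℓ) (α β u₁ u₂ u₃ u₄ : CommutativeRing.Carrier R) →
  let open CommutativeRing R
      open Weight R α β u₁ u₂ u₃ u₄
  in α + β ≈ - 1# → ∀ m → Q (3 ℕ.+ m) ≈ c₁ * Q (2 ℕ.+ m) - c₂ * Q (1 ℕ.+ m)
Q-recurrence R α β u₁ u₂ u₃ u₄ α+β≈-1 zero = begin
  Q 3                    ≈⟨ Q-step 1 ⟩
  y * Q 2 + Q′ 2         ≈⟨ +-cong (*-congˡ Q-two) (Q′-two α+β≈-1) ⟩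
  y * y + - v            ≈⟨ solve 3 (λ y s v → y :* y :+ :- v := (y :+ y :+ s) :* y :- (y :* y :+ y :* s :+ v) :* :1)
                                  refl y (u₃ + u₄) v ⟩
  c₁ * y - c₂ * 1#       ≈⟨ +-cong (*-congˡ Q-two) (-‿cong (*-congˡ Q-one)) ⟨
  c₁ * Q 2 - c₂ * Q 1    ∎
  where
  open CommutativeRing R
  open import Relation.Binary.Reasoning.Setoid setoid
  open IntegerCoefficients R
  open Weight R α β u₁ u₂ u₃ u₄
  open Lift R α β u₁ u₂ u₃ u₄

Q-recurrence R α β u₁ u₂ u₃ u₄ α+β≈-1 (suc m) = begin
  Q (4 ℕ.+ m)                                          ≈⟨ Q-step (2 ℕ.+ m) ⟩
  y * Q (3 ℕ.+ m) + Q′ (3 ℕ.+ m)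
    ≈⟨ +-cong (*-congˡ (Q-recurrence R α β u₁ u₂ u₃ u₄ α+β≈-1 m)) Q′-recurrence ⟩
  y * (c₁ * Q₂ - c₂ * Q₁) + ((c₁ * Q′₂ + 0# * Q₂) - (c₂ * Q′₁ + 0# * Q₁))
    ≈⟨ solve 7 (λ y c₁ c₂ Q₂ Q₁ Q′₂ Q′₁ →
                 y :* (c₁ :* Q₂ :- c₂ :* Q₁) :+ ((c₁ :* Q′₂ :+ :0 :* Q₂) :- (c₂ :* Q′₁ :+ :0 :* Q₁))
                 := c₁ :* (y :* Q₂ :+ Q′₂) :- c₂ :* (y :* Q₁ :+ Q′₁)) refl y c₁ c₂ Q₂ Q₁ Q′₂ Q′₁ ⟩
  c₁ * (y * Q₂ + Q′₂) - c₂ * (y * Q₁ + Q′₁)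
    ≈⟨ +-cong (*-congˡ (Q-step (1 ℕ.+ m))) (-‿cong (*-congˡ (Q-step m))) ⟨
  c₁ * Q (3 ℕ.+ m) - c₂ * Q (2 ℕ.+ m)                  ∎
  where
  open CommutativeRing R
  open import Relation.Binary.Reasoning.Setoid setoid
  open import Algebra.Properties.Ring ring using (-0#≈0#)
  open IntegerCoefficients R
  open Weight R α β u₁ u₂ u₃ u₄
  open Lift R α β u₁ u₂ u₃ u₄
  Q₂ Q₁ Q′₂ Q′₁ : Carrier
  Q₂  = Q (2 ℕ.+ m)
  Q₁  = Q (1 ℕ.+ m)
  Q′₂ = Q′ (2 ℕ.+ m)
  Q′₁ = Q′ (1 ℕ.+ m)
  Q′-recurrence : Q′ (3 ℕ.+ m) ≈ (c₁ * Q′₂ + 0# * Q₂) - (c₂ * Q′₁ + 0# * Q₁)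
  Q′-recurrence = trans (sym (Q-lift₂ (3 ℕ.+ m)))
    (trans (proj₂ (Q-recurrence (R [ε]) α̃ β̃ ũ₁ ũ₂ ũ₃ ũ₄ (α+β≈-1 , trans (+-identityʳ 0#) (sym -0#≈0#)) m))
           (+-cong (+-cong (*-congˡ (Q-lift₂ (2 ℕ.+ m))) (*-cong (c₁-lift₂ α+β≈-1) (Q-lift₁ (2 ℕ.+ m))))
                   (-‿cong (+-cong (*-congˡ (Q-lift₂ (1 ℕ.+ m))) (*-cong (c₂-lift₂ α+β≈-1) (Q-lift₁ (1 ℕ.+ m)))))))

module Statistics where

  open import Data.Nat using (_+_)
  open import Data.Nat.Properties
    using (m≤n⇒m∸n≡0; +-∸-assoc; _≤?_; ≰⇒>; m<n⇒m<1+n; ≤-refl; m≤n⇒m≤1+n; suc-injective; +-suc; m≤n+m;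
           n≤1+n; ≤-trans; +-comm; +-identityʳ)
  open import Data.Bool.Properties using (∧-zeroʳ)
  open import Relation.Binary.PropositionalEquality using (refl; sym; trans; cong; subst; module ≡-Reasoning)

  private
    +≡⇒≤ : ∀ k {a b} → k + a ≡ b → a ≤ b
    +≡⇒≤ k {a} eq = subst (a ≤_) eq (m≤n+m a k)

  module _ (P : ℕ → Bool) where

    countRange-empty : ∀ a b → b < a → countRange P a b ≡ 0
    countRange-empty a b b<a with suc b ∸ a | m≤n⇒m∸n≡0 b<a
    ... | .0 | refl = refl

    countRange-unfold : ∀ a b → a ≤ b →
      countRange P a b ≡ (if P a then suc (countRange P (suc a) b) else countRange P (suc a) b)
    countRange-unfold a b a≤b with suc b ∸ a | +-∸-assoc 1 a≤b
    ... | .(suc (b ∸ a)) | refl = refl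

    countRange-dropFirst : ∀ a b → P a ≡ false → countRange P a b ≡ countRange P (suc a) b
    countRange-dropFirst a b Pa≡false with a ≤? b
    ... | yes a≤b rewrite countRange-unfold a b a≤b | Pa≡false = refl
    ... | no  a≰b = trans (countRange-empty a b (≰⇒> a≰b)) (sym (countRange-empty (suc a) b (m<n⇒m<1+n (≰⇒> a≰b))))

    countRange-dropLast : ∀ k a b → k + a ≡ suc b → P (suc b) ≡ false → countRange P a (suc b) ≡ countRange P a b
    countRange-dropLast zero .(suc b) b refl Pb≡false rewrite countRange-unfold (suc b) (suc b) ≤-refl | Pb≡false =
      trans (countRange-empty (suc (suc b)) (suc b) ≤-refl) (sym (countRange-empty (suc b) b ≤-refl))
    countRange-dropLast (suc k) a b eq Pb≡false
      rewrite countRange-unfold a (suc b) (m≤n⇒m≤1+n (+≡⇒≤ k (suc-injective eq)))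
            | countRange-unfold a b (+≡⇒≤ k (suc-injective eq))
            | countRange-dropLast k (suc a) b (trans (+-suc k a) eq) Pb≡false = refl

  module _ (P P′ : ℕ → Bool) where

    countRange-shift : ∀ k a b → k + a ≡ b → (∀ i → a ≤ i → P (suc i) ≡ P′ i) →
      countRange P (suc a) (suc b) ≡ countRange P′ a b
    countRange-shift zero a .a refl P≡P′
      rewrite countRange-unfold P (suc a) (suc a) ≤-refl | countRange-unfold P′ a a ≤-refl | P≡P′ a ≤-refl
            | countRange-empty P (suc (suc a)) (suc a) ≤-refl | countRange-empty P′ (suc a) a ≤-refl = refl
    countRange-shift (suc k) a b eq P≡P′
      rewrite countRange-unfold P (suc a) (suc b) (s≤s (+≡⇒≤ (suc k) eq)) | countRange-unfold P′ a b (+≡⇒≤ (suc k) eq)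
            | P≡P′ a ≤-refl
            | countRange-shift k (suc a) b (trans (+-suc k a) eq) (λ i a<i → P≡P′ i (≤-trans (n≤1+n a) a<i)) = refl

    countRange-cong : ∀ k a b → k + a ≡ suc b → (∀ i → P i ≡ P′ i) → countRange P a b ≡ countRange P′ a b
    countRange-cong zero .(suc b) b refl P≡P′ =
      trans (countRange-empty P (suc b) b ≤-refl) (sym (countRange-empty P′ (suc b) b ≤-refl))
    countRange-cong (suc k) a b eq P≡P′
      rewrite countRange-unfold P a b (+≡⇒≤ k (suc-injective eq)) | countRange-unfold P′ a b (+≡⇒≤ k (suc-injective eq))
            | P≡P′ a
            | countRange-cong k (suc a) b (trans (+-suc k a) eq) P≡P′ = refl

  scan : (ℕ → ℕ → ℕ → Bool) → ℕ → List ℕ → ℕ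
  scan F p []       = 0
  scan F p (x ∷ xs) = if F p x (head₀ xs) then suc (scan F x xs) else scan F x xs

  atFrom : ℕ → List ℕ → ℕ → ℕ
  atFrom p σ zero    = p
  atFrom p σ (suc i) = at σ (suc i)

  patternAt : (ℕ → ℕ → ℕ → Bool) → ℕ → List ℕ → ℕ → Bool
  patternAt F p σ i = F (atFrom p σ (i ∸ 1)) (atFrom p σ i) (atFrom p σ (suc i))

  countRange-patternAt≡scan : ∀ F p σ → countRange (patternAt F p σ) 1 (length σ) ≡ scan F p σ
  countRange-patternAt≡scan F p []           = refl
  countRange-patternAt≡scan F p (x ∷ [])     = countRange-unfold (patternAt F p (x ∷ [])) 1 1 ≤-refl
  countRange-patternAt≡scan F p (x ∷ y ∷ ys) =
    trans (countRange-unfold (patternAt F p (x ∷ y ∷ ys)) 1 (suc (length (y ∷ ys))) (s≤s z≤n))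
          (cong (λ n → if F p x y then suc n else n)
                (trans (countRange-shift (patternAt F p (x ∷ y ∷ ys)) (patternAt F x (y ∷ ys)) (length ys) 1 (length (y ∷ ys))
                                         (+-comm (length ys) 1) shifted)
                       (countRange-patternAt≡scan F x (y ∷ ys))))
    where
    shifted : ∀ i → 1 ≤ i → patternAt F p (x ∷ y ∷ ys) (suc i) ≡ patternAt F x (y ∷ ys) i
    shifted (suc zero)    _ = refl
    shifted (suc (suc j)) _ = refl

  valley peak doubleDescent doubleAscent : ℕ → ℕ → ℕ → Bool
  valley        p x q = (x <ᵇ p) ∧ (x <ᵇ q)
  peak          p x q = (p <ᵇ x) ∧ (q <ᵇ x)
  doubleDescent p x q = (x <ᵇ p) ∧ (q <ᵇ x)
  doubleAscent  p x q = (p <ᵇ x) ∧ (x <ᵇ q)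

  private
    at-beyond : ∀ σ → at σ (suc (length σ)) ≡ 0
    at-beyond []           = refl
    at-beyond (x ∷ [])     = refl
    at-beyond (x ∷ y ∷ ys) = at-beyond (y ∷ ys)

    at≡patternAt : ∀ F σ i → F (at σ (i ∸ 1)) (at σ i) (at σ (suc i)) ≡ patternAt F 0 σ i
    at≡patternAt F σ zero          = refl
    at≡patternAt F σ (suc zero)    = refl
    at≡patternAt F σ (suc (suc i)) = refl

    +1 : ∀ n → n + 1 ≡ suc n
    +1 n = +-comm n 1

  -- The boundary indices that Defs leaves out of V, rdd and lda contribute nothing to the scans.
  V≡scan : ∀ k xs → V (suc k ∷ xs) ≡ scan valley 0 (suc k ∷ xs)
  V≡scan k xs = begin
    countRange pat 2 (length xs)                   ≡⟨ countRange-dropFirst pat 1 (length xs) refl ⟨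
    countRange pat 1 (length xs)                   ≡⟨ countRange-dropLast pat (length xs) 1 (length xs) (+1 (length xs)) pat-last ⟨
    countRange pat 1 (length σ)
      ≡⟨ countRange-cong pat (patternAt valley 0 σ) (length σ) 1 (length σ) (+1 (length σ)) (at≡patternAt valley σ) ⟩
    countRange (patternAt valley 0 σ) 1 (length σ) ≡⟨ countRange-patternAt≡scan valley 0 σ ⟩
    scan valley 0 σ                              ∎
    where
    open ≡-Reasoning
    σ : List ℕ
    σ = suc k ∷ xs
    pat : ℕ → Bool
    pat i = (at σ i <ᵇ at σ (i ∸ 1)) ∧ (at σ i <ᵇ at σ (suc i))
    pat-last : pat (length σ) ≡ false
    pat-last rewrite at-beyond σ = ∧-zeroʳ _

  W≡scan : ∀ σ → W σ ≡ scan peak 0 σ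
  W≡scan σ = trans (countRange-cong _ (patternAt peak 0 σ) (length σ) 1 (length σ) (+1 (length σ)) (at≡patternAt peak σ))
                   (countRange-patternAt≡scan peak 0 σ)

  rdd≡scan : ∀ k xs → rdd (suc k ∷ xs) ≡ scan doubleDescent 0 (suc k ∷ xs)
  rdd≡scan k xs = trans (sym (countRange-dropFirst pat 1 (length σ) refl))
    (trans (countRange-cong pat (patternAt doubleDescent 0 σ) (length σ) 1 (length σ) (+1 (length σ)) (at≡patternAt doubleDescent σ))
           (countRange-patternAt≡scan doubleDescent 0 σ))
    where
    σ : List ℕ
    σ = suc k ∷ xs
    pat : ℕ → Bool
    pat i = (at σ i <ᵇ at σ (i ∸ 1)) ∧ (at σ (suc i) <ᵇ at σ i)

  lda≡scan : ∀ k xs → lda (suc k ∷ xs) ≡ scan doubleAscent 0 (suc k ∷ xs)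
  lda≡scan k xs = trans (sym (countRange-dropLast pat (length xs) 1 (length xs) (+1 (length xs)) pat-last))
    (trans (countRange-cong pat (patternAt doubleAscent 0 σ) (length σ) 1 (length σ) (+1 (length σ)) (at≡patternAt doubleAscent σ))
           (countRange-patternAt≡scan doubleAscent 0 σ))
    where
    σ : List ℕ
    σ = suc k ∷ xs
    pat : ℕ → Bool
    pat i = (at σ (i ∸ 1) <ᵇ at σ i) ∧ (at σ i <ᵇ at σ (suc i))
    pat-last : pat (length σ) ≡ false
    pat-last rewrite at-beyond σ = ∧-zeroʳ _

  <ᵇ-flip : ∀ {m n} → m ≢ n → (n <ᵇ m) ≡ not (m <ᵇ n)
  <ᵇ-flip {zero}  {zero}  m≢n = ⊥-elim (m≢n refl)
  <ᵇ-flip {zero}  {suc n} _   = refl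
  <ᵇ-flip {suc m} {zero}  _   = refl
  <ᵇ-flip {suc m} {suc n} m≢n = <ᵇ-flip (λ eq → m≢n (cong suc eq))

  head₀-distinct : ∀ x xs → 1 ≤ x → PositiveDistinct x xs → x ≢ head₀ xs
  head₀-distinct (suc k) []      _ _              = λ ()
  head₀-distinct x       (_ ∷ _) _ (_ , x≢y , _) = x≢y

  -- peaks and valleys alternate
  scan-peak≡scan-valley+𝟙 : ∀ p x xs → PositiveDistinct p (x ∷ xs) →
    scan peak p (x ∷ xs) ≡ scan valley p (x ∷ xs) + 𝟙 (p <ᵇ x)
  scan-peak≡scan-valley+𝟙 p (suc k) [] (_ , p≢x , _) rewrite <ᵇ-flip p≢x with p <ᵇ suc k
  ... | true  = refl
  ... | false = refl
  scan-peak≡scan-valley+𝟙 p x (y ∷ ys) (_ , p≢x , pd@(_ , x≢y , _))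
    rewrite scan-peak≡scan-valley+𝟙 x y ys pd | <ᵇ-flip p≢x | <ᵇ-flip x≢y with p <ᵇ x | x <ᵇ y
  ... | true  | true  = refl
  ... | true  | false = trans (cong suc (+-identityʳ _)) (sym (+-comm _ 1))
  ... | false | true  = trans (+-comm _ 1) (sym (+-identityʳ _))
  ... | false | false = refl

open Statistics

module StatisticsWeight {c ℓ} (R : CommutativeRing c ℓ) (α β u₁ u₂ u₃ u₄ : CommutativeRing.Carrier R) where
  open CommutativeRing R
  open import Relation.Binary.Reasoning.Setoid setoid
  open IntegerCoefficients R
  open Weight R α β u₁ u₂ u₃ u₄

  monomial : ℕ → ℕ → ℕ → Carrier
  monomial i j l = pow R u₁ i * pow R u₂ i * pow R u₃ j * pow R u₄ l

  monomial-scan≈weight : ∀ p xs → PositiveDistinct p xs →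
    monomial (scan valley p xs) (scan doubleDescent p xs) (scan doubleAscent p xs) ≈ weight p xs
  monomial-scan≈weight p []       _ = trans (*-identityʳ _) (trans (*-identityʳ _) (*-identityʳ _))
  monomial-scan≈weight p (x ∷ xs) (1≤x , p≢x , pd) with IH ← monomial-scan≈weight x xs pd
    rewrite <ᵇ-flip p≢x | <ᵇ-flip (head₀-distinct x xs 1≤x pd) with p <ᵇ x | x <ᵇ head₀ xs
  ... | true  | true  = trans (solve 5 (λ a b d e u → a :* b :* d :* (u :* e) := u :* (a :* b :* d :* e)) refl _ _ _ _ u₄) (*-congˡ IH)
  ... | true  | false = trans (sym (*-identityˡ _)) (*-congˡ IH)
  ... | false | true  = trans (solve 6 (λ a b d e u w → (u :* a) :* (w :* b) :* d :* e := (u :* w) :* (a :* b :* d :* e))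
                                       refl _ _ _ _ u₁ u₂) (*-congˡ IH)
  ... | false | false = trans (solve 5 (λ a b d e u → a :* b :* (u :* d) :* e := u :* (a :* b :* d :* e)) refl _ _ _ _ u₃) (*-congˡ IH)

  term : List ℕ → Carrier
  term σ = pow R u₁ (V σ) * pow R u₂ (W σ ∸ 1) * pow R u₃ (rdd σ) * pow R u₄ (lda σ)
           * pow R α (LRmax σ ∸ 1) * pow R β (RLmax σ ∸ 1)

  term≈totalWeight : ∀ σ → σ ≢ [] → PositiveDistinct 0 σ → term σ ≈ totalWeight σ
  term≈totalWeight []           ne _  = ⊥-elim (ne ≡.refl)
  term≈totalWeight (suc k ∷ ts) _  pd = begin
    term σ                                                   ≡⟨ exponents ⟩
    monomial (scan valley 0 σ) (scan doubleDescent 0 σ) (scan doubleAscent 0 σ) * a * b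
                                                             ≈⟨ *-assoc _ a b ⟩
    monomial (scan valley 0 σ) (scan doubleDescent 0 σ) (scan doubleAscent 0 σ) * (a * b)
                                                             ≈⟨ *-congʳ (monomial-scan≈weight 0 σ pd) ⟩
    totalWeight σ                                            ∎
    where
    σ : List ℕ
    σ = suc k ∷ ts
    a b : Carrier
    a = pow R α (LRmax σ ∸ 1)
    b = pow R β (rlmax σ ∸ 1)
    W∸1≡V : W σ ∸ 1 ≡ scan valley 0 σ
    W∸1≡V = ≡.trans (≡.cong (_∸ 1) (≡.trans (W≡scan σ) (scan-peak≡scan-valley+𝟙 0 (suc k) ts pd))) (ℕ.m+n∸n≡m _ 1)
    exponents : term σ ≡ monomial (scan valley 0 σ) (scan doubleDescent 0 σ) (scan doubleAscent 0 σ) * a * b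
    exponents rewrite V≡scan k ts | W∸1≡V | rdd≡scan k ts | lda≡scan k ts | RLmax≡rlmax σ = ≡.refl

  P≈Q : ∀ n → P R n u₁ u₂ u₃ u₄ α β ≈ Q (suc n)
  P≈Q n = begin
    ∑ (S (suc n)) term   ≈⟨ ∑-S≈∑-S′ (suc n) term ⟩
    ∑ (S′ (suc n)) term  ≈⟨ ∑-congᴬ (All.zipWith (λ {σ} (ne , pd) → term≈totalWeight σ ne pd)
                                                (S′-nonempty n , S′-PositiveDistinct (suc n))) ⟩
    Q (suc n)            ∎
    where open ListSum R

n≤1+2⌊n/2⌋ : ∀ n → n ≤ suc (2 ℕ.* ⌊ n /2⌋)
n≤1+2⌊n/2⌋ zero          = z≤n
n≤1+2⌊n/2⌋ (suc zero)    = s≤s z≤n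
n≤1+2⌊n/2⌋ (suc (suc n)) = s≤s (s≤s (≡.subst (n ≤_) (≡.sym (ℕ.+-suc ⌊ n /2⌋ (⌊ n /2⌋ ℕ.+ 0))) (n≤1+2⌊n/2⌋ n)))

2*suc : ∀ k → 2 ℕ.* suc k ≡ suc (suc (2 ℕ.* k))
2*suc k = ≡.cong suc (ℕ.+-suc k (k ℕ.+ 0))

⌊n/2⌋<k⇒n<2k : ∀ n k → ⌊ n /2⌋ < k → n < 2 ℕ.* k
⌊n/2⌋<k⇒n<2k n (suc k) (s≤s ⌊n/2⌋≤k) =
  ℕ.≤-trans (s≤s (ℕ.≤-trans (n≤1+2⌊n/2⌋ n) (s≤s (ℕ.*-monoʳ-≤ 2 ⌊n/2⌋≤k)))) (ℕ.≤-reflexive (≡.sym (2*suc k)))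

module SumTo {c ℓ} (R : CommutativeRing c ℓ) where
  open CommutativeRing R
  open IntegerCoefficients R

  sumTo-cong : ∀ N {f g : ℕ → Carrier} → (∀ k → f k ≈ g k) → sumTo R N f ≈ sumTo R N g
  sumTo-cong zero    f≈g = f≈g 0
  sumTo-cong (suc N) f≈g = +-cong (sumTo-cong N f≈g) (f≈g (suc N))

  sumTo-+ : ∀ N (f g : ℕ → Carrier) → sumTo R N (λ k → f k + g k) ≈ sumTo R N f + sumTo R N g
  sumTo-+ zero    f g = refl
  sumTo-+ (suc N) f g = trans (+-congʳ (sumTo-+ N f g)) (interchange _ _ _ _)
    where open import Algebra.Properties.CommutativeSemigroup +-commutativeSemigroup using (interchange)

  sumTo-distribˡ : ∀ N k (f : ℕ → Carrier) → sumTo R N (λ i → k * f i) ≈ k * sumTo R N f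
  sumTo-distribˡ zero    k f = refl
  sumTo-distribˡ (suc N) k f = trans (+-congʳ (sumTo-distribˡ N k f)) (sym (distribˡ _ _ _))

  sumTo-suc : ∀ N (f : ℕ → Carrier) → sumTo R (suc N) f ≈ f 0 + sumTo R N (λ k → f (suc k))
  sumTo-suc zero    f = refl
  sumTo-suc (suc N) f = trans (+-congʳ (sumTo-suc N f)) (+-assoc _ _ _)

  sumTo-extend : ∀ N d (f : ℕ → Carrier) → (∀ k → N < k → f k ≈ 0#) → sumTo R (d ℕ.+ N) f ≈ sumTo R N f
  sumTo-extend N zero    f f≈0 = refl
  sumTo-extend N (suc d) f f≈0 = trans (+-cong (sumTo-extend N d f f≈0) (f≈0 (suc (d ℕ.+ N)) (s≤s (ℕ.m≤n+m N d)))) (+-identityʳ _)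

  sumTo-extend-≤ : ∀ N M (f : ℕ → Carrier) → N ≤ M → (∀ k → N < k → f k ≈ 0#) → sumTo R N f ≈ sumTo R M f
  sumTo-extend-≤ N M f N≤M f≈0 =
    sym (trans (reflexive (≡.cong (λ K → sumTo R K f) (≡.sym (ℕ.m∸n+n≡m N≤M)))) (sumTo-extend N (M ∸ N) f f≈0))

  natR-+ : ∀ m n → natR R (m ℕ.+ n) ≈ natR R m + natR R n
  natR-+ zero    n = sym (+-identityˡ _)
  natR-+ (suc m) n = trans (+-congˡ (natR-+ m n)) (sym (+-assoc _ _ _))

  natR-pascal : ∀ n m → natR R (suc n C suc m) ≈ natR R (n C m) + natR R (n C suc m)
  natR-pascal n m = trans (reflexive (≡.cong (natR R) (≡.sym (nCk+nC[k+1]≡[n+1]C[k+1] n m)))) (natR-+ (n C m) (n C suc m))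

module BinomialSums {c ℓ} (R : CommutativeRing c ℓ) (α β u₁ u₂ u₃ u₄ : CommutativeRing.Carrier R) where
  open CommutativeRing R
  open import Relation.Binary.Reasoning.Setoid setoid
  open IntegerCoefficients R
  open SumTo R

  ξ s Δ : Carrier
  ξ = (β - α) * (u₃ - u₄)
  s = u₃ + u₄
  Δ = pow R (u₃ + u₄) 2 - (natR R 4 * u₁ * u₂)

  term : Carrier → ℕ → ℕ → Carrier
  term c k j = c * pow R Δ k * pow R (β - α) j * pow R (u₃ - u₄) j

  -- evenSum n + oddSum n √Δ = (ξ + √Δ)ⁿ
  evenTerm oddTerm : ℕ → ℕ → Carrier
  evenTerm n k = term (natR R (n C (2 ℕ.* k))) k (n ∸ 2 ℕ.* k)
  oddTerm  n k = term (natR R (n C suc (2 ℕ.* k))) k (n ∸ suc (2 ℕ.* k))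

  evenSum oddSum : ℕ → Carrier
  evenSum n = sumTo R n (evenTerm n)
  oddSum  n = sumTo R n (oddTerm n)

  term-zero : ∀ k j → term 0# k j ≈ 0#
  term-zero k j = trans (*-congʳ (trans (*-congʳ (zeroˡ _)) (zeroˡ _))) (zeroˡ _)

  term-C-zero : ∀ n m k j → n < m → term (natR R (n C m)) k j ≈ 0#
  term-C-zero n m k j n<m = ≡.subst (λ i → term (natR R i) k j ≈ 0#) (≡.sym (k>n⇒nCk≡0 n<m)) (term-zero k j)

  evenTerm-zero : ∀ n k → ⌊ n /2⌋ < k → evenTerm n k ≈ 0#
  evenTerm-zero n k lt = term-C-zero n (2 ℕ.* k) k (n ∸ 2 ℕ.* k) (⌊n/2⌋<k⇒n<2k n k lt)

  oddTerm-zero : ∀ n k → ⌊ n /2⌋ < k → oddTerm n k ≈ 0#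
  oddTerm-zero n k lt = term-C-zero n (suc (2 ℕ.* k)) k (n ∸ suc (2 ℕ.* k)) (ℕ.m<n⇒m<1+n (⌊n/2⌋<k⇒n<2k n k lt))

  RHS≈evenSum-oddSum : ∀ n → RHS R n u₁ u₂ u₃ u₄ α β ≈ evenSum n - s * oddSum n
  RHS≈evenSum-oddSum n = +-cong (sumTo-extend-≤ ⌊ n /2⌋ n (evenTerm n) (ℕ.⌊n/2⌋≤n n) (evenTerm-zero n))
                                (-‿cong (*-congˡ (sumTo-extend-≤ ⌊ n /2⌋ n (oddTerm n) (ℕ.⌊n/2⌋≤n n) (oddTerm-zero n))))

  term-suc : ∀ c k j → term c k (suc j) ≈ ξ * term c k j
  term-suc c k j = solve 6 (λ c P b g b′ g′ → c :* P :* (b :* b′) :* (g :* g′) := (b :* g) :* (c :* P :* b′ :* g′))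
                           refl c (pow R Δ k) (β - α) (u₃ - u₄) (pow R (β - α) j) (pow R (u₃ - u₄) j)

  term-+ : ∀ c c′ k j → term (c + c′) k j ≈ term c k j + term c′ k j
  term-+ c c′ k j = solve 5 (λ c c′ P b g → (c :+ c′) :* P :* b :* g := c :* P :* b :* g :+ c′ :* P :* b :* g)
                            refl c c′ (pow R Δ k) (pow R (β - α) j) (pow R (u₃ - u₄) j)

  -- for n ≤ m both sides vanish, whatever the truncated n ∸ m
  term-C-∸ : ∀ n m k → term (natR R (n C suc m)) k (n ∸ m) ≈ ξ * term (natR R (n C suc m)) k (n ∸ suc m)
  term-C-∸ n m k with suc m ℕ.≤? n
  ... | yes m<n = trans (reflexive (≡.cong (term (natR R (n C suc m)) k) (ℕ.+-∸-assoc 1 m<n))) (term-suc _ k (n ∸ suc m))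
  ... | no  m≮n = trans (term-C-zero n (suc m) k (n ∸ m) (ℕ.≰⇒> m≮n))
                        (sym (trans (*-congˡ (term-C-zero n (suc m) k (n ∸ suc m) (ℕ.≰⇒> m≮n))) (zeroʳ ξ)))

  evenTerm-suc-zero : ∀ n → evenTerm (suc n) 0 ≈ ξ * evenTerm n 0
  evenTerm-suc-zero n = term-suc (natR R 1) 0 n

  evenTerm-suc-suc : ∀ n k → evenTerm (suc n) (suc k) ≈ ξ * evenTerm n (suc k) + Δ * oddTerm n k
  evenTerm-suc-suc n k = begin
    term (natR R (suc n C (2 ℕ.* suc k))) (suc k) (suc n ∸ 2 ℕ.* suc k)
      ≡⟨ ≡.cong (λ M → term (natR R (suc n C M)) (suc k) (suc n ∸ M)) (2*suc k) ⟩
    term (natR R (suc n C suc m)) (suc k) (n ∸ m)    ≈⟨ *-congʳ (*-congʳ (*-congʳ (natR-pascal n m))) ⟩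
    term (natR R (n C m) + natR R (n C suc m)) (suc k) (n ∸ m)
      ≈⟨ trans (term-+ (natR R (n C m)) (natR R (n C suc m)) (suc k) (n ∸ m)) (+-comm _ _) ⟩
    term (natR R (n C suc m)) (suc k) (n ∸ m) + term (natR R (n C m)) (suc k) (n ∸ m)
      ≈⟨ +-cong (term-C-∸ n m (suc k))
                (solve 5 (λ c d P b g → c :* (d :* P) :* b :* g := d :* (c :* P :* b :* g))
                         refl (natR R (n C m)) Δ (pow R Δ k) (pow R (β - α) (n ∸ m)) (pow R (u₃ - u₄) (n ∸ m))) ⟩
    ξ * term (natR R (n C suc m)) (suc k) (n ∸ suc m) + Δ * oddTerm n k
      ≡⟨ ≡.cong (λ M → ξ * term (natR R (n C M)) (suc k) (n ∸ M) + Δ * oddTerm n k) (≡.sym (2*suc k)) ⟩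
    ξ * evenTerm n (suc k) + Δ * oddTerm n k ∎
    where
    m : ℕ
    m = suc (2 ℕ.* k)

  oddTerm-suc : ∀ n k → oddTerm (suc n) k ≈ evenTerm n k + ξ * oddTerm n k
  oddTerm-suc n k = begin
    term (natR R (suc n C suc (2 ℕ.* k))) k (n ∸ 2 ℕ.* k)         ≈⟨ *-congʳ (*-congʳ (*-congʳ (natR-pascal n (2 ℕ.* k)))) ⟩
    term (natR R (n C (2 ℕ.* k)) + natR R (n C suc (2 ℕ.* k))) k (n ∸ 2 ℕ.* k)
      ≈⟨ term-+ (natR R (n C (2 ℕ.* k))) (natR R (n C suc (2 ℕ.* k))) k (n ∸ 2 ℕ.* k) ⟩
    evenTerm n k + term (natR R (n C suc (2 ℕ.* k))) k (n ∸ 2 ℕ.* k) ≈⟨ +-congˡ (term-C-∸ n (2 ℕ.* k) k) ⟩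
    evenTerm n k + ξ * oddTerm n k                                 ∎

  sumTo-suc-≈ : ∀ n (f : ℕ → Carrier) → (∀ k → ⌊ n /2⌋ < k → f k ≈ 0#) → sumTo R (suc n) f ≈ sumTo R n f
  sumTo-suc-≈ n f f≈0 = trans (+-congˡ (f≈0 (suc n) (s≤s (ℕ.⌊n/2⌋≤n n)))) (+-identityʳ _)

  evenSum-suc : ∀ n → evenSum (suc n) ≈ ξ * evenSum n + Δ * oddSum n
  evenSum-suc n = begin
    sumTo R (suc n) (evenTerm (suc n))                              ≈⟨ sumTo-suc n (evenTerm (suc n)) ⟩
    evenTerm (suc n) 0 + sumTo R n (λ k → evenTerm (suc n) (suc k))
      ≈⟨ +-cong (evenTerm-suc-zero n) (sumTo-cong n (evenTerm-suc-suc n)) ⟩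
    ξ * evenTerm n 0 + sumTo R n (λ k → ξ * evenTerm n (suc k) + Δ * oddTerm n k)
      ≈⟨ +-congˡ (trans (sumTo-+ n _ _) (+-cong (sumTo-distribˡ n ξ _) (sumTo-distribˡ n Δ (oddTerm n)))) ⟩
    ξ * evenTerm n 0 + (ξ * sumTo R n (λ k → evenTerm n (suc k)) + Δ * oddSum n)
      ≈⟨ trans (sym (+-assoc _ _ _)) (+-congʳ (sym (distribˡ ξ _ _))) ⟩
    ξ * (evenTerm n 0 + sumTo R n (λ k → evenTerm n (suc k))) + Δ * oddSum n
      ≈⟨ +-congʳ (*-congˡ (trans (sym (sumTo-suc n (evenTerm n))) (sumTo-suc-≈ n (evenTerm n) (evenTerm-zero n)))) ⟩
    ξ * evenSum n + Δ * oddSum n ∎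

  oddSum-suc : ∀ n → oddSum (suc n) ≈ evenSum n + ξ * oddSum n
  oddSum-suc n = begin
    sumTo R (suc n) (oddTerm (suc n))                      ≈⟨ sumTo-cong (suc n) (oddTerm-suc n) ⟩
    sumTo R (suc n) (λ k → evenTerm n k + ξ * oddTerm n k) ≈⟨ sumTo-+ (suc n) _ _ ⟩
    sumTo R (suc n) (evenTerm n) + sumTo R (suc n) (λ k → ξ * oddTerm n k)
      ≈⟨ +-cong (sumTo-suc-≈ n (evenTerm n) (evenTerm-zero n))
                (trans (sumTo-distribˡ (suc n) ξ (oddTerm n)) (*-congˡ (sumTo-suc-≈ n (oddTerm n) (oddTerm-zero n)))) ⟩
    evenSum n + ξ * oddSum n                               ∎

  RHS-recurrence : ∀ n → RHS R (2 ℕ.+ n) u₁ u₂ u₃ u₄ α β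
    ≈ (ξ + ξ) * RHS R (suc n) u₁ u₂ u₃ u₄ α β - (ξ * ξ - Δ) * RHS R n u₁ u₂ u₃ u₄ α β
  RHS-recurrence n = begin
    RHS R (2 ℕ.+ n) u₁ u₂ u₃ u₄ α β                     ≈⟨ RHS≈evenSum-oddSum (2 ℕ.+ n) ⟩
    evenSum (2 ℕ.+ n) - s * oddSum (2 ℕ.+ n)            ≈⟨ +-cong (evenSum-suc (suc n)) (-‿cong (*-congˡ (oddSum-suc (suc n)))) ⟩
    (ξ * A′ + Δ * B′) - s * (A′ + ξ * B′)
      ≈⟨ +-cong (+-cong (*-congˡ (evenSum-suc n)) (*-congˡ (oddSum-suc n)))
                (-‿cong (*-congˡ (+-cong (evenSum-suc n) (*-congˡ (oddSum-suc n))))) ⟩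
    (ξ * (ξ * A + Δ * B) + Δ * (A + ξ * B)) - s * ((ξ * A + Δ * B) + ξ * (A + ξ * B))
      ≈⟨ solve 5 (λ ξ Δ s A B → let A′ = ξ :* A :+ Δ :* B ; B′ = A :+ ξ :* B in
                   (ξ :* A′ :+ Δ :* B′) :- s :* (A′ :+ ξ :* B′)
                   := (ξ :+ ξ) :* (A′ :- s :* B′) :- (ξ :* ξ :- Δ) :* (A :- s :* B))
                 refl ξ Δ s A B ⟩
    (ξ + ξ) * ((ξ * A + Δ * B) - s * (A + ξ * B)) - (ξ * ξ - Δ) * (A - s * B)
      ≈⟨ +-cong (*-congˡ (trans (RHS≈evenSum-oddSum (suc n)) (+-cong (evenSum-suc n) (-‿cong (*-congˡ (oddSum-suc n))))))
                (-‿cong (*-congˡ (RHS≈evenSum-oddSum n))) ⟨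
    (ξ + ξ) * RHS R (suc n) u₁ u₂ u₃ u₄ α β - (ξ * ξ - Δ) * RHS R n u₁ u₂ u₃ u₄ α β ∎
    where
    A B A′ B′ : Carrier
    A  = evenSum n
    B  = oddSum n
    A′ = evenSum (suc n)
    B′ = oddSum (suc n)

module _ {c ℓ} (R : CommutativeRing c ℓ) where
  open CommutativeRing R

  recurrence-unique : ∀ (a b : Carrier) (f g : ℕ → Carrier) →
    (∀ n → f (2 ℕ.+ n) ≈ a * f (suc n) - b * f n) → (∀ n → g (2 ℕ.+ n) ≈ a * g (suc n) - b * g n) →
    f 0 ≈ g 0 → f 1 ≈ g 1 → ∀ n → f n ≈ g n
  recurrence-unique a b f g f-rec g-rec f0≈g0 f1≈g1 n = proj₁ (consecutive n)
    where
    consecutive : ∀ n → f n ≈ g n × f (suc n) ≈ g (suc n)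
    consecutive zero    = f0≈g0 , f1≈g1
    consecutive (suc n) with fn≈gn , fn+1≈gn+1 ← consecutive n =
      fn+1≈gn+1 , trans (f-rec n) (trans (+-cong (*-congˡ fn+1≈gn+1) (-‿cong (*-congˡ fn≈gn))) (sym (g-rec n)))

module MainIdentity {c ℓ} (R : CommutativeRing c ℓ) (α β u₁ u₂ u₃ u₄ : CommutativeRing.Carrier R) where
  open CommutativeRing R
  open import Relation.Binary.Reasoning.Setoid setoid
  open IntegerCoefficients R
  open Weight R α β u₁ u₂ u₃ u₄ using (Q; c₁; c₂; Q-one; Q-two)
  open BinomialSums R α β u₁ u₂ u₃ u₄ using (ξ; Δ; RHS-recurrence)

  two : Carrier
  two = 1# + 1#

  T : ℕ → Carrier
  T n = pow R two n * Q (suc n)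

  module _ (α+β≈-1 : α + β ≈ - 1#) where

    α+β+1≈0 : α + β + 1# ≈ 0#
    α+β+1≈0 = trans (+-congʳ α+β≈-1) (-‿inverseˡ 1#)

    modulo-α+β+1 : ∀ {L M} K → L ≈ M + (α + β + 1#) * K → L ≈ M
    modulo-α+β+1 K L≈M+0 = trans L≈M+0 (trans (+-congˡ (trans (*-congʳ α+β+1≈0) (zeroˡ K))) (+-identityʳ _))

    two*c₁ : two * c₁ ≈ ξ + ξ
    two*c₁ = modulo-α+β+1 (two * (u₃ + u₄)) (solve 4 (λ α β u₃ u₄ →
      let y = α :* u₄ :+ β :* u₃ ; s = u₃ :+ u₄ ; ξ = (β :- α) :* (u₃ :- u₄) ; two = :1 :+ :1 in
      two :* (y :+ y :+ s) := (ξ :+ ξ) :+ (α :+ β :+ :1) :* (two :* s)) refl α β u₃ u₄)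

    four*c₂ : (two * two) * c₂ ≈ ξ * ξ - Δ
    four*c₂ = modulo-α+β+1 ((u₃ + u₄) * (c₁ + ξ)) (solve 6 (λ α β u₁ u₂ u₃ u₄ →
      let y = α :* u₄ :+ β :* u₃ ; s = u₃ :+ u₄ ; ξ = (β :- α) :* (u₃ :- u₄) ; two = :1 :+ :1
          four = :1 :+ (:1 :+ (:1 :+ (:1 :+ :0))) in
      (two :* two) :* (y :* y :+ y :* s :+ u₁ :* u₂)
        := (ξ :* ξ :- (s :* (s :* :1) :- four :* u₁ :* u₂)) :+ (α :+ β :+ :1) :* (s :* ((y :+ y :+ s) :+ ξ)))
      refl α β u₁ u₂ u₃ u₄)

    T-recurrence : ∀ m → T (2 ℕ.+ m) ≈ (ξ + ξ) * T (suc m) - (ξ * ξ - Δ) * T m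
    T-recurrence m = begin
      two * (two * p) * Q (3 ℕ.+ m)                                 ≈⟨ *-congˡ (Q-recurrence R α β u₁ u₂ u₃ u₄ α+β≈-1 m) ⟩
      two * (two * p) * (c₁ * Q (2 ℕ.+ m) - c₂ * Q (1 ℕ.+ m))
        ≈⟨ solve 6 (λ t p c₁ c₂ q₂ q₁ →
                     t :* (t :* p) :* (c₁ :* q₂ :- c₂ :* q₁) := (t :* c₁) :* ((t :* p) :* q₂) :- ((t :* t) :* c₂) :* (p :* q₁))
                   refl two p c₁ c₂ (Q (2 ℕ.+ m)) (Q (1 ℕ.+ m)) ⟩
      (two * c₁) * T (suc m) - ((two * two) * c₂) * T m             ≈⟨ +-cong (*-congʳ two*c₁) (-‿cong (*-congʳ four*c₂)) ⟩
      (ξ + ξ) * T (suc m) - (ξ * ξ - Δ) * T m                       ∎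
      where
      p : Carrier
      p = pow R two m

    -- the solver terms follow the unfolded RHS (natR 1 = 1# + 0#, pow x 0 = 1#)
    T-zero : T 0 ≈ RHS R 0 u₁ u₂ u₃ u₄ α β
    T-zero = trans (*-identityˡ (Q 1)) (trans Q-one (solve 1 (λ s →
      :1 := ((:1 :+ :0) :* :1) :* :1 :* :1 :- s :* (:0 :* :1 :* :1 :* :1)) refl (u₃ + u₄)))

    T-one : T 1 ≈ RHS R 1 u₁ u₂ u₃ u₄ α β
    T-one = trans (*-congˡ Q-two) (modulo-α+β+1 (u₃ + u₄) (solve 4 (λ α β u₃ u₄ →
      let one = (:1 :+ :0) :* :1 in
      ((:1 :+ :1) :* :1) :* (α :* u₄ :+ β :* u₃)
        := (one :* ((β :- α) :* :1) :* ((u₃ :- u₄) :* :1) :- (u₃ :+ u₄) :* (one :* :1 :* :1))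
           :+ (α :+ β :+ :1) :* (u₃ :+ u₄)) refl α β u₃ u₄))

    T≈RHS : ∀ n → T n ≈ RHS R n u₁ u₂ u₃ u₄ α β
    T≈RHS = recurrence-unique R (ξ + ξ) (ξ * ξ - Δ) T (λ n → RHS R n u₁ u₂ u₃ u₄ α β)
                              T-recurrence RHS-recurrence T-zero T-one

mainTheorem11 : ∀ {c ℓ} (R : CommutativeRing c ℓ) →
    let open CommutativeRing R in
    (α β u₁ u₂ u₃ u₄ : Carrier) → α + β ≈ - 1# →
    (n : ℕ) → n ≥ 1 →
    pow R (1# + 1#) n * P R n u₁ u₂ u₃ u₄ α β ≈ RHS R n u₁ u₂ u₃ u₄ α β
mainTheorem11 R α β u₁ u₂ u₃ u₄ α+β≈-1 n _ =
  trans (*-congˡ (StatisticsWeight.P≈Q R α β u₁ u₂ u₃ u₄ n)) (MainIdentity.T≈RHS R α β u₁ u₂ u₃ u₄ α+β≈-1 n)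
  where open CommutativeRing R
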